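{- Let $t>1$. For $1\le s,s'\le t$ let $\mathbf{U}_{s,s'}$ and $\mathbf{W}_{s,s'}$ be the matrices indexed by $\mathcal{H}_s\times\mathcal{H}_{s'}$ with $\mathbf{U}_{s,s'}(i,j)=g(H_i\mid H_j)(v)$ and $\mathbf{W}_{s,s'}(i,j)=f(H_i\mid H_j)(v)$, where $v$ is in the designated orbit of $H_j$, and let $\mathbf{U}_s=\mathbf{U}_{s,s}$. Let $\widetilde{\mathbf{U}}_t=[\mathbf{U}_{s,s'}]_{s,s'=1}^t$ and $\widetilde{\mathbf{W}}_t=[\mathbf{W}_{s,s'}]_{s,s'=1}^t$ be the block matrices. Then $\widetilde{\mathbf{U}}_t$ and $\widetilde{\mathbf{W}}_t$ are block upper triangular and $$\widetilde{\mathbf{W}}_t=\mathrm{diag}(\mathbf{U}_1^{ -1},\dots,\mathbf{U}_t^{ -1})\,\widetilde{\mathbf{U}}_t.$$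
   Context: All graphs are finite, undirected and simple. For a connected graph $H$, the automorphism group partitions $V(H)$ into orbits. A graphlet $H_\sigma$ is a connected graph $H$ (up to isomorphism) with one designated orbit $\sigma$; $\mathcal{H}_s$ is the finite set of all graphlets with $s$ nodes (identified up to isomorphisms preserving the designated orbit), ordered in a fixed way. For a graph $G$, $v\in V(G)$ and graphlet $H_\sigma$: the gross count $g(H_\sigma\mid G)(v)$ is the number of distinct (not necessarily induced) subgraphs $H'$ of $G$ isomorphic to $H$ via an isomorphism under which $v$ lies in the orbit of $H'$ corresponding to $\sigma$; the net count $f(H_\sigma\mid G)(v)$ is the number of such $H'$ that are induced subgraphs of $G$. In $g(H_i\mid H_j)(v)$ and $f(H_i\mid H_j)(v)$, $H_j$ is regarded as the source graph. -}

module Defs where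

open import Data.Nat using (ℕ; zero; suc)
open import Data.Fin using (Fin; zero; suc)
open import Data.Fin.Properties using (any?; all?) renaming (_≟_ to _≟F_)
open import Data.Bool using (Bool; true; false)
open import Data.Bool.Properties using () renaming (_≟_ to _≟B_)
open import Data.Vec using (Vec; []; _∷_; lookup)
open import Data.List using (List; []; _∷_; [_]; filter; length; map; concatMap; cartesianProduct)
open import Data.Product using (Σ; ∃; _×_; _,_)
open import Relation.Binary.PropositionalEquality using (_≡_)
open import Relation.Nullary using (Dec; yes; no)
open import Relation.Nullary.Decidable using (_×-dec_; _→-dec_)
open import Data.Rational using (ℚ; 0ℚ; 1ℚ; _+_; _*_; _/_)
open import Data.Integer using (+_)

record Graph (n : ℕ) : Set where
  field
    adj    : Fin n → Fin n → Bool
    sym    : ∀ u v → adj u v ≡ adj v u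
    irrefl : ∀ u → adj u u ≡ false
open Graph public

data Reach {n : ℕ} (G : Graph n) : Fin n → Fin n → Set where
  here : ∀ {u} → Reach G u u
  step : ∀ {u w v} → adj G u w ≡ true → Reach G w v → Reach G u v

Connected : ∀ {n} → Graph n → Set
Connected G = ∀ u v → Reach G u v

-- Maps Fin m → Fin n are represented as vectors (so they can be searched)

Injective : ∀ {m n} → Vec (Fin n) m → Set
Injective {m} φ = ∀ (a b : Fin m) → lookup φ a ≡ lookup φ b → a ≡ b

IsIso : ∀ {m n} → Graph m → Graph n → Vec (Fin n) m → Set
IsIso {m} {n} H G φ =
  Injective φ ×
  (∀ (u : Fin n) → ∃ λ (a : Fin m) → lookup φ a ≡ u) ×
  (∀ (a b : Fin m) → adj H a b ≡ adj G (lookup φ a) (lookup φ b))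

Orbit : ∀ {m} → Graph m → Fin m → Fin m → Set
Orbit H r u = ∃ λ α → IsIso H H α × lookup α r ≡ u

-- Graphlets: a connected graph with a designated orbit, given as the
-- Aut-orbit of the vertex 'root'.

record Graphlet (s : ℕ) : Set where
  field
    graph     : Graph s
    connected : Connected graph
    root      : Fin s
open Graphlet public

GraphletIso : ∀ {s} → Graphlet s → Graphlet s → Set
GraphletIso X Y =
  ∃ λ φ → IsIso (graph X) (graph Y) φ × Orbit (graph Y) (root Y) (lookup φ (root X))

-- R : Fin N → Graphlet s lists every graphlet with s nodes exactly once up
-- to isomorphism (i.e. R is an ordering of ℋ_s)
IsGraphletEnumeration : (s N : ℕ) → (Fin N → Graphlet s) → Set
IsGraphletEnumeration s N R =
  (∀ (X : Graphlet s) → ∃ λ i → GraphletIso X (R i)) ×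
  (∀ i j → GraphletIso (R i) (R j) → i ≡ j)

-- Subgraphs of G : Graph n, given by vertex set S and edge set E
-- (each subgraph corresponds to exactly one pair (S , E) satisfying IsSubgraph)

Edges : ℕ → Set
Edges n = Vec (Vec Bool n) n

E[_,_,_] : ∀ {n} → Edges n → Fin n → Fin n → Bool
E[ E , x , y ] = lookup (lookup E x) y

IsSubgraph : ∀ {n} → Graph n → Vec Bool n → Edges n → Set
IsSubgraph {n} G S E =
  (∀ (x y : Fin n) → E[ E , x , y ] ≡ true →
      adj G x y ≡ true × lookup S x ≡ true × lookup S y ≡ true) ×
  (∀ (x y : Fin n) → E[ E , x , y ] ≡ E[ E , y , x ])

IsInduced : ∀ {n} → Graph n → Vec Bool n → Edges n → Set
IsInduced {n} G S E =
  ∀ (x y : Fin n) → lookup S x ≡ true → lookup S y ≡ true → E[ E , x , y ] ≡ adj G x y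

IsIsoSub : ∀ {m n} → Graph m → Vec Bool n → Edges n → Vec (Fin n) m → Set
IsIsoSub {m} {n} H S E φ =
  Injective φ ×
  (∀ (a : Fin m) → lookup S (lookup φ a) ≡ true) ×
  (∀ (u : Fin n) → lookup S u ≡ true → ∃ λ (a : Fin m) → lookup φ a ≡ u) ×
  (∀ (a b : Fin m) → adj H a b ≡ E[ E , lookup φ a , lookup φ b ])

Occurrence : ∀ {m n} → Graph m → Fin m → Graph n → Fin n → Vec Bool n × Edges n → Set
Occurrence H r G v (S , E) =
  IsSubgraph G S E ×
  ∃ λ φ → IsIsoSub H S E φ × ∃ λ u → Orbit H r u × lookup φ u ≡ v

InducedOccurrence : ∀ {m n} → Graph m → Fin m → Graph n → Fin n → Vec Bool n × Edges n → Set
InducedOccurrence H r G v (S , E) = Occurrence H r G v (S , E) × IsInduced G S E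

∃Vec? : ∀ {n m} {P : Vec (Fin n) m → Set} → (∀ v → Dec (P v)) → Dec (∃ P)
∃Vec? {m = zero} P? with P? []
... | yes p = yes ([] , p)
... | no ¬p = no λ { ([] , p) → ¬p p }
∃Vec? {n} {suc m} {P} P? with any? (λ a → ∃Vec? {n} {m} {λ v → P (a ∷ v)} (λ v → P? (a ∷ v)))
... | yes (a , v , p) = yes (a ∷ v , p)
... | no ¬q = no λ { (a ∷ v , p) → ¬q (a , v , p) }

Injective? : ∀ {m n} (φ : Vec (Fin n) m) → Dec (Injective φ)
Injective? φ = all? λ a → all? λ b → (lookup φ a ≟F lookup φ b) →-dec (a ≟F b)

IsIso? : ∀ {m n} (H : Graph m) (G : Graph n) φ → Dec (IsIso H G φ)
IsIso? H G φ =
  Injective? φ ×-dec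
  (all? λ u → any? λ a → lookup φ a ≟F u) ×-dec
  (all? λ a → all? λ b → adj H a b ≟B adj G (lookup φ a) (lookup φ b))

Orbit? : ∀ {m} (H : Graph m) r u → Dec (Orbit H r u)
Orbit? H r u = ∃Vec? λ α → IsIso? H H α ×-dec (lookup α r ≟F u)

IsSubgraph? : ∀ {n} (G : Graph n) S E → Dec (IsSubgraph G S E)
IsSubgraph? G S E =
  (all? λ x → all? λ y → (E[ E , x , y ] ≟B true) →-dec
     ((adj G x y ≟B true) ×-dec (lookup S x ≟B true) ×-dec (lookup S y ≟B true))) ×-dec
  (all? λ x → all? λ y → E[ E , x , y ] ≟B E[ E , y , x ])

IsInduced? : ∀ {n} (G : Graph n) S E → Dec (IsInduced G S E)
IsInduced? G S E = all? λ x → all? λ y →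
  (lookup S x ≟B true) →-dec (lookup S y ≟B true) →-dec (E[ E , x , y ] ≟B adj G x y)

IsIsoSub? : ∀ {m n} (H : Graph m) S E φ → Dec (IsIsoSub {m} {n} H S E φ)
IsIsoSub? H S E φ =
  Injective? φ ×-dec
  (all? λ a → lookup S (lookup φ a) ≟B true) ×-dec
  (all? λ u → (lookup S u ≟B true) →-dec (any? λ a → lookup φ a ≟F u)) ×-dec
  (all? λ a → all? λ b → adj H a b ≟B E[ E , lookup φ a , lookup φ b ])

Occurrence? : ∀ {m n} (H : Graph m) r (G : Graph n) v p → Dec (Occurrence H r G v p)
Occurrence? H r G v (S , E) =
  IsSubgraph? G S E ×-dec
  (∃Vec? λ φ → IsIsoSub? H S E φ ×-dec
     (any? λ u → Orbit? H r u ×-dec (lookup φ u ≟F v)))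

InducedOccurrence? : ∀ {m n} (H : Graph m) r (G : Graph n) v p → Dec (InducedOccurrence H r G v p)
InducedOccurrence? H r G v (S , E) = Occurrence? H r G v (S , E) ×-dec IsInduced? G S E

-- Enumeration of all candidate pairs (S , E); each vector occurs once

allVecs : ∀ {A : Set} → List A → (m : ℕ) → List (Vec A m)
allVecs xs zero = [ [] ]
allVecs xs (suc m) = concatMap (λ x → map (x ∷_) (allVecs xs m)) xs

bools : List Bool
bools = true ∷ false ∷ []

candidates : (n : ℕ) → List (Vec Bool n × Edges n)
candidates n = cartesianProduct (allVecs bools n) (allVecs (allVecs bools n) n)

grossCount : ∀ {s n} → Graphlet s → Graph n → Fin n → ℕ
grossCount {s} {n} X G v = length (filter (Occurrence? (graph X) (root X) G v) (candidates n))

netCount : ∀ {s n} → Graphlet s → Graph n → Fin n → ℕ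
netCount {s} {n} X G v = length (filter (InducedOccurrence? (graph X) (root X) G v) (candidates n))

Mat : ℕ → ℕ → Set
Mat m n = Fin m → Fin n → ℚ

ℕtoℚ : ℕ → ℚ
ℕtoℚ k = + k / 1

sumFin : (k : ℕ) → (Fin k → ℚ) → ℚ
sumFin zero f = 0ℚ
sumFin (suc k) f = f zero + sumFin k (λ i → f (suc i))

_·_ : ∀ {m k n} → Mat m k → Mat k n → Mat m n
_·_ {k = k} A B i j = sumFin k (λ l → A i l * B l j)

idMat : (n : ℕ) → Mat n n
idMat n i j with i ≟F j
... | yes _ = 1ℚ
... | no _ = 0ℚ

_≈M_ : ∀ {m n} → Mat m n → Mat m n → Set
A ≈M B = ∀ i j → A i j ≡ B i j

-- The blocks U_{s,s'} and W_{s,s'} with respect to an enumeration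
-- R s : Fin (N s) → Graphlet s of ℋ_s, and a chosen vertex v s j in the
-- designated orbit of the graphlet R s j.

UBlock : (N : ℕ → ℕ) (R : (s : ℕ) → Fin (N s) → Graphlet s)
         (v : (s : ℕ) → Fin (N s) → Fin s) (s s' : ℕ) → Mat (N s) (N s')
UBlock N R v s s' i j = ℕtoℚ (grossCount (R s i) (graph (R s' j)) (v s' j))

WBlock : (N : ℕ → ℕ) (R : (s : ℕ) → Fin (N s) → Graphlet s)
         (v : (s : ℕ) → Fin (N s) → Fin s) (s s' : ℕ) → Mat (N s) (N s')
WBlock N R v s s' i j = ℕtoℚ (netCount (R s i) (graph (R s' j)) (v s' j))

-- Classifying the occurrences of a graphlet X in G by the graphlet induced on their vertex sets
-- gives g(X | G)(v) = Σₖ g(X | Hₖ)(vₖ) f(Hₖ | G)(v), that is U_{s,s'} = U_s W_{s,s'}: the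
-- occurrences with a fixed vertex set S are the occurrences of X in the graphlet G[S] ≅ Hₖ,
-- transported along that isomorphism. No graph contains an occurrence of a larger one, which gives
-- block triangularity. Within one size, an occurrence of Hᵢ in Hⱼ is either an isomorphism, which
-- forces i = j and is the only occurrence, or misses an edge of Hⱼ. So U_s has unit diagonal and
-- is triangular with respect to edge counts, I - U_s is nilpotent, and W_{s,s'} = U_s⁻¹ U_{s,s'}.

module Submission where

open import Defs hiding (sym)

open import Algebra.Bundles using (Ring)
open import Data.Bool using (Bool; true; false; _∧_)
open import Data.Bool.Properties using (∧-comm; ∧-conicalˡ; ∧-conicalʳ) renaming (_≟_ to _≟ᴮ_)
open import Data.Empty using (⊥; ⊥-elim)
open import Data.Fin using (Fin; zero; suc; punchOut)
open import Data.Fin.Properties using (any?; all?; ¬∀⟶∃¬; punchOut-injective; injective⇒≤;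
  suc-injective) renaming (_≟_ to _≟ᶠ_)
import Data.Integer as ℤ
import Data.Integer.Properties as ℤₚ
open import Data.List as List using (List; []; _∷_; [_]; _++_; length; filter; map; allFin;
  concatMap; cartesianProductWith; cartesianProduct)
open import Data.List.Properties using (filter-++; length-++; filter-none; filter-notAll;
  filter-accept; filter-reject; filter-≐; length-map; length-filter)
open import Data.List.Membership.Propositional using (_∈_; _∉_)
open import Data.List.Membership.Propositional.Properties using (∈-filter⁺; ∈-filter⁻; ∈-map⁻;
  ∈-allFin; ∈-cartesianProductWith⁺; ∈-cartesianProduct⁺)
open import Data.List.Relation.Unary.All as All using (All; []; _∷_)
open import Data.List.Relation.Unary.All.Properties using (all-filter; ¬Any⇒All¬)
import Data.List.Relation.Unary.Any as Any
open import Data.List.Relation.Unary.Any using (here; there)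
open import Data.List.Relation.Unary.AllPairs using ([]; _∷_)
open import Data.List.Relation.Unary.Unique.Propositional using (Unique)
open import Data.List.Relation.Unary.Unique.Propositional.Properties using (filter⁺; allFin⁺;
  cartesianProductWith⁺; cartesianProduct⁺)
open import Data.Nat as ℕ using (ℕ; zero; suc; _≤_; _<_; z≤n; s≤s)
import Data.Nat.Properties as ℕₚ
open import Data.Product using (Σ; ∃; _×_; _,_; proj₁; proj₂)
import Data.Product.Properties as Product
open import Data.Rational using (ℚ; 0ℚ; 1ℚ; _+_; _*_; -_; _-_; toℚᵘ)
import Data.Rational.Properties as ℚₚ
open import Data.Rational.Unnormalised as ℚᵘ using (ℚᵘ; mkℚᵘ; *≡*)
import Data.Rational.Unnormalised.Properties as ℚᵘₚ
open import Data.Sum using (_⊎_; inj₁; inj₂)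
open import Data.Vec as Vec using (Vec; []; _∷_; lookup; tabulate)
import Data.Vec.Properties as Vecₚ
open import Function using (_∘_)
open import Relation.Binary.Bundles using (Setoid)
open import Relation.Binary.Definitions using (DecidableEquality)
open import Relation.Binary.PropositionalEquality
  using (_≡_; _≢_; refl; sym; trans; cong; cong₂; subst; module ≡-Reasoning)
open import Relation.Nullary using (Dec; yes; no; ¬_)
open import Relation.Nullary.Decidable using (_×-dec_; ¬?)
open import Relation.Unary using (Decidable)

open import Algebra.Properties.Semiring.Sum (Ring.semiring ℚₚ.+-*-ring)
  using (sum; sum-cong-≗; ∑-comm; ∑-distrib-+; *-distribˡ-sum; *-distribʳ-sum; sum-replicate-zero)

count : ∀ {A : Set} {P : A → Set} → Decidable P → List A → ℕ
count P? xs = length (filter P? xs)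

Enumerates : ∀ {A : Set} → List A → Set
Enumerates xs = Unique xs × (∀ x → x ∈ xs)

module _ {A : Set} {P : A → Set} (P? : Decidable P) where

  count-++ : ∀ xs ys → count P? (xs ++ ys) ≡ count P? xs ℕ.+ count P? ys
  count-++ xs ys = trans (cong length (filter-++ P? xs ys)) (length-++ (filter P? xs))

  count-none : ∀ xs → (∀ x → ¬ P x) → count P? xs ≡ 0
  count-none xs ¬P = cong length (filter-none P? (All.universal ¬P xs))

  count-accept : ∀ {x} → P x → count P? [ x ] ≡ 1
  count-accept px = cong length (filter-accept P? px)

  count-reject : ∀ {x} → ¬ P x → count P? [ x ] ≡ 0
  count-reject ¬px = cong length (filter-reject P? ¬px)

  count≢0⇒∃ : ∀ xs → count P? xs ≢ 0 → ∃ P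
  count≢0⇒∃ [] ≢0 = ⊥-elim (≢0 refl)
  count≢0⇒∃ (x ∷ xs) ≢0 with P? x
  ... | yes px = x , px
  ... | no _ = count≢0⇒∃ xs ≢0

  count≡1 : ∀ {x₀ xs} → Unique xs → x₀ ∈ xs → P x₀ → (∀ x → P x → x ≡ x₀) → count P? xs ≡ 1
  count≡1 {xs = x ∷ xs} (x∉xs ∷ _) (here refl) px₀ only-x₀ with P? x
  ... | no ¬px = ⊥-elim (¬px px₀)
  ... | yes _ = cong suc (cong length (filter-none P?
                  (All.map (λ {y} x≢y py → x≢y (sym (only-x₀ y py))) x∉xs)))
  count≡1 {xs = x ∷ xs} (x∉xs ∷ u) (there x₀∈xs) px₀ only-x₀ with P? x
  ... | yes px = ⊥-elim (All.lookup x∉xs x₀∈xs (only-x₀ x px))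
  ... | no _ = count≡1 u x₀∈xs px₀ only-x₀

count-cong : ∀ {A : Set} {P Q : A → Set} (P? : Decidable P) (Q? : Decidable Q) →
  (∀ x → P x → Q x) → (∀ x → Q x → P x) → ∀ xs → count P? xs ≡ count Q? xs
count-cong P? Q? P⇒Q Q⇒P xs = cong length (filter-≐ P? Q? ((λ {x} → P⇒Q x) , (λ {x} → Q⇒P x)) xs)

module _ {A : Set} (_≟_ : DecidableEquality A) where

  length-mono-⊆ : ∀ {L M : List A} → Unique L → (∀ {x} → x ∈ L → x ∈ M) → length L ≤ length M
  length-mono-⊆ {[]} _ _ = z≤n
  length-mono-⊆ {x ∷ L} {M} (x∉L ∷ uL) L⊆M =
    ℕₚ.≤-trans (s≤s (length-mono-⊆ uL L⊆M-x)) (filter-notAll (¬? ∘ (x ≟_)) M x∈M)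
    where
    x∈M = Any.map (λ x≡y x≢y → x≢y x≡y) (L⊆M (here refl))
    L⊆M-x : ∀ {y} → y ∈ L → y ∈ filter (¬? ∘ (x ≟_)) M
    L⊆M-x y∈L = ∈-filter⁺ (¬? ∘ (x ≟_)) (L⊆M (there y∈L)) (All.lookup x∉L y∈L)

  length-<-⊆ : ∀ {L M : List A} {y} → Unique L → (∀ {x} → x ∈ L → x ∈ M) → y ∈ M → y ∉ L →
    length L < length M
  length-<-⊆ {L} uL L⊆M y∈M y∉L = length-mono-⊆ (¬Any⇒All¬ L y∉L ∷ uL) yL⊆M
    where
    yL⊆M : ∀ {x} → x ∈ _ ∷ L → x ∈ _
    yL⊆M (here refl) = y∈M
    yL⊆M (there x∈L) = L⊆M x∈L

module _ {A B : Set} (_≟_ : DecidableEquality B) {P : A → Set} {Q : B → Set}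
         (P? : Decidable P) (Q? : Decidable Q)
         (f : A → B) (f-preserves : ∀ x → P x → Q (f x))
         (f-injective : ∀ x y → P x → P y → f x ≡ f y → x ≡ y)
         {xs : List A} {ys : List B} (xs-unique : Unique xs) (ys-complete : ∀ y → y ∈ ys) where

  private
    map-unique : ∀ {zs} → All P zs → Unique zs → Unique (map f zs)
    map-unique [] [] = []
    map-unique (pz ∷ pzs) (z∉zs ∷ uzs) = apart pzs z∉zs ∷ map-unique pzs uzs
      where
      apart : ∀ {ws} → All P ws → All (_ ≢_) ws → All (f _ ≢_) (map f ws)
      apart [] [] = []
      apart (pw ∷ pws) (z≢w ∷ z≢ws) = (λ eq → z≢w (f-injective _ _ pz pw eq)) ∷ apart pws z≢ws

    image = map f (filter P? xs)

    image-unique : Unique image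
    image-unique = map-unique (all-filter P? xs) (filter⁺ P? xs-unique)

    image⊆ : ∀ {y} → y ∈ image → y ∈ filter Q? ys
    image⊆ y∈ with ∈-map⁻ f y∈
    ... | x , x∈ , refl =
      ∈-filter⁺ Q? (ys-complete (f x)) (f-preserves x (proj₂ (∈-filter⁻ P? {xs = xs} x∈)))

  count-≤-injection : count P? xs ≤ count Q? ys
  count-≤-injection = subst (_≤ count Q? ys) (length-map f (filter P? xs))
    (length-mono-⊆ _≟_ image-unique image⊆)

  count-<-injection : ∀ y → Q y → (∀ x → P x → f x ≢ y) → count P? xs < count Q? ys
  count-<-injection y qy missed = subst (_< count Q? ys) (length-map f (filter P? xs))
    (length-<-⊆ _≟_ image-unique image⊆ (∈-filter⁺ Q? (ys-complete y) qy) y∉image)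
    where
    y∉image : y ∉ image
    y∉image y∈ with ∈-map⁻ f y∈
    ... | x , x∈ , y≡fx = missed x (proj₂ (∈-filter⁻ P? {xs = xs} x∈)) (sym y≡fx)

count-bijection : ∀ {A B : Set} {P : A → Set} {Q : B → Set}
  (_≟ᴬ_ : DecidableEquality A) (_≟ᴮ_ : DecidableEquality B) (P? : Decidable P) (Q? : Decidable Q)
  {xs : List A} {ys : List B} → Enumerates xs → Enumerates ys →
  (F : A → B) (G : B → A) → (∀ x → P x → Q (F x)) → (∀ y → Q y → P (G y)) →
  (∀ x → P x → G (F x) ≡ x) → (∀ y → Q y → F (G y) ≡ y) →
  count P? xs ≡ count Q? ys
count-bijection _≟ᴬ_ _≟ᴮ_ P? Q? (uxs , cxs) (uys , cys) F G F-pres G-pres GF FG = ℕₚ.≤-antisym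
  (count-≤-injection _≟ᴮ_ P? Q? F F-pres (injective-on F G GF) uxs cys)
  (count-≤-injection _≟ᴬ_ Q? P? G G-pres (injective-on G F FG) uys cxs)
  where
  injective-on : ∀ {C D : Set} {R : C → Set} (h : C → D) (k : D → C) → (∀ c → R c → k (h c) ≡ c) →
    ∀ c c' → R c → R c' → h c ≡ h c' → c ≡ c'
  injective-on h k kh c c' rc rc' eq = trans (sym (kh c rc)) (trans (cong k eq) (kh c' rc'))

sumBy : ∀ {A : Set} → List A → (A → ℕ) → ℕ
sumBy [] f = 0
sumBy (x ∷ xs) f = f x ℕ.+ sumBy xs f

module _ {A : Set} where

  sumBy-cong : ∀ xs {f g : A → ℕ} → (∀ x → f x ≡ g x) → sumBy xs f ≡ sumBy xs g
  sumBy-cong [] f≗g = refl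
  sumBy-cong (x ∷ xs) f≗g = cong₂ ℕ._+_ (f≗g x) (sumBy-cong xs f≗g)

  sumBy-+ : ∀ xs (f g : A → ℕ) → sumBy xs (λ x → f x ℕ.+ g x) ≡ sumBy xs f ℕ.+ sumBy xs g
  sumBy-+ [] f g = refl
  sumBy-+ (x ∷ xs) f g = trans (cong (f x ℕ.+ g x ℕ.+_) (sumBy-+ xs f g))
    (+-interchange (f x) (g x) (sumBy xs f) (sumBy xs g))
    where open import Algebra.Properties.CommutativeSemigroup ℕₚ.+-commutativeSemigroup
            using () renaming (interchange to +-interchange)

  sumBy-zero : ∀ xs → sumBy {A} xs (λ _ → 0) ≡ 0
  sumBy-zero [] = refl
  sumBy-zero (x ∷ xs) = sumBy-zero xs

  sumBy-indicator : ∀ {Q : A → Set} (Q? : Decidable Q) xs {f : A → ℕ} c →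
    (∀ x → Q x → f x ≡ c) → (∀ x → ¬ Q x → f x ≡ 0) → sumBy xs f ≡ c ℕ.* count Q? xs
  sumBy-indicator Q? [] c _ _ = sym (ℕₚ.*-zeroʳ c)
  sumBy-indicator Q? (x ∷ xs) c on off with Q? x
  ... | yes qx = trans (cong₂ ℕ._+_ (on x qx) (sumBy-indicator Q? xs c on off))
                       (sym (ℕₚ.*-suc c (count Q? xs)))
  ... | no ¬qx = cong₂ ℕ._+_ (off x ¬qx) (sumBy-indicator Q? xs c on off)

module _ {A B : Set} {P : A → Set} {T : A → B → Set} (P? : Decidable P) (T? : ∀ x y → Dec (T x y))
         (ys : List B) (one-fibre : ∀ x → P x → count (T? x) ys ≡ 1) where

  private
    in-fibre? : ∀ y → Decidable (λ x → P x × T x y)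
    in-fibre? y x = P? x ×-dec T? x y

  count-fibres : ∀ xs → count P? xs ≡ sumBy ys (λ y → count (in-fibre? y) xs)
  count-fibres [] = sym (sumBy-zero ys)
  count-fibres (x ∷ xs) = begin
    count P? (x ∷ xs)
      ≡⟨ count-++ P? [ x ] xs ⟩
    count P? [ x ] ℕ.+ count P? xs
      ≡⟨ cong₂ ℕ._+_ head (count-fibres xs) ⟩
    sumBy ys (λ y → count (in-fibre? y) [ x ]) ℕ.+ sumBy ys (λ y → count (in-fibre? y) xs)
      ≡⟨ sumBy-+ ys _ _ ⟨
    sumBy ys (λ y → count (in-fibre? y) [ x ] ℕ.+ count (in-fibre? y) xs)
      ≡⟨ sumBy-cong ys (λ y → count-++ (in-fibre? y) [ x ] xs) ⟨
    sumBy ys (λ y → count (in-fibre? y) (x ∷ xs)) ∎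
    where
    open ≡-Reasoning
    head : count P? [ x ] ≡ sumBy ys (λ y → count (in-fibre? y) [ x ])
    head = by-cases (P? x)
      where
      by-cases : Dec (P x) → count P? [ x ] ≡ sumBy ys (λ y → count (in-fibre? y) [ x ])
      by-cases (yes px) = begin
        count P? [ x ]                   ≡⟨ count-accept P? px ⟩
        1                                ≡⟨ one-fibre x px ⟨
        count (T? x) ys                  ≡⟨ ℕₚ.*-identityˡ _ ⟨
        1 ℕ.* count (T? x) ys            ≡⟨ sumBy-indicator (T? x) ys 1
                                              (λ y t → count-accept (in-fibre? y) (px , t))
                                              (λ y ¬t → count-reject (in-fibre? y) (¬t ∘ proj₂)) ⟨
        sumBy ys (λ y → count (in-fibre? y) [ x ]) ∎
      by-cases (no ¬px) = trans (count-reject P? ¬px)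
        (sym (sumBy-indicator (T? x) ys 0 (λ y _ → count-reject (in-fibre? y) (¬px ∘ proj₁))
                                          (λ y _ → count-reject (in-fibre? y) (¬px ∘ proj₁))))

Candidate : ℕ → Set
Candidate n = Vec Bool n × Edges n

_≟ⱽ_ : ∀ {n} → DecidableEquality (Vec Bool n)
_≟ⱽ_ = Vecₚ.≡-dec _≟ᴮ_

_≟ᶜ_ : ∀ {n} → DecidableEquality (Candidate n)
_≟ᶜ_ = Product.≡-dec _≟ⱽ_ (Vecₚ.≡-dec _≟ⱽ_)

allVecs-enumerates : ∀ {A : Set} {xs : List A} → Enumerates xs → ∀ m → Enumerates (allVecs xs m)
allVecs-enumerates _ zero = [] ∷ [] , λ { [] → here refl }
allVecs-enumerates {xs = xs} enum (suc m) =
  subst Enumerates (sym (as-product xs))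
    ( cartesianProductWith⁺ _∷_ Vecₚ.∷-injective (proj₁ enum) (proj₁ rest)
    , λ { (a ∷ v) → ∈-cartesianProductWith⁺ _∷_ (proj₂ enum a) (proj₂ rest v) })
  where
  rest = allVecs-enumerates enum m
  as-product : ∀ ys → concatMap (λ y → map (y ∷_) (allVecs xs m)) ys
                    ≡ cartesianProductWith _∷_ ys (allVecs xs m)
  as-product [] = refl
  as-product (y ∷ ys) = cong (map (y ∷_) (allVecs xs m) ++_) (as-product ys)

candidates-enumerate : ∀ n → Enumerates (candidates n)
candidates-enumerate n =
  cartesianProduct⁺ (proj₁ subsets) (proj₁ edgeSets) ,
  λ { (S , E) → ∈-cartesianProduct⁺ (proj₂ subsets S) (proj₂ edgeSets E) }
  where
  bools-enumerate : Enumerates bools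
  bools-enumerate = ((λ ()) ∷ []) ∷ [] ∷ [] , λ { true → here refl ; false → there (here refl) }
  subsets = allVecs-enumerates bools-enumerate n
  edgeSets = allVecs-enumerates subsets n

lookup-ext : ∀ {A : Set} {n} {u v : Vec A n} → (∀ i → lookup u i ≡ lookup v i) → u ≡ v
lookup-ext {u = u} {v} u≗v =
  trans (sym (Vecₚ.tabulate∘lookup u)) (trans (Vecₚ.tabulate-cong u≗v) (Vecₚ.tabulate∘lookup v))

edges-ext : ∀ {n} {E E' : Edges n} → (∀ x y → E[ E , x , y ] ≡ E[ E' , x , y ]) → E ≡ E'
edges-ext E≗E' = lookup-ext (λ x → lookup-ext (E≗E' x))

_∘ᵛ_ : ∀ {m n k} → Vec (Fin n) m → Vec (Fin m) k → Vec (Fin n) k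
θ ∘ᵛ φ = Vec.map (lookup θ) φ

lookup-∘ᵛ : ∀ {m n k} (θ : Vec (Fin n) m) (φ : Vec (Fin m) k) a →
  lookup (θ ∘ᵛ φ) a ≡ lookup θ (lookup φ a)
lookup-∘ᵛ θ φ a = Vecₚ.lookup-map a (lookup θ) φ

full : ∀ {n} → Vec Bool n
full {n} = Vec.replicate n true

lookup-full : ∀ {n} (x : Fin n) → lookup full x ≡ true
lookup-full x = Vecₚ.lookup-replicate x true

lookup-tabulate₂ : ∀ {n} (f : Fin n → Fin n → Bool) x y →
  E[ tabulate {n = n} (λ x → tabulate (f x)) , x , y ] ≡ f x y
lookup-tabulate₂ f x y =
  trans (cong (λ row → lookup row y) (Vecₚ.lookup∘tabulate _ x)) (Vecₚ.lookup∘tabulate _ y)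

injective⇒surjective : ∀ {s} (φ : Vec (Fin s) s) → Injective φ → ∀ u → ∃ λ a → lookup φ a ≡ u
injective⇒surjective {suc s} φ φ-inj u with any? (λ a → lookup φ a ≟ᶠ u)
... | yes hit = hit
... | no miss = ⊥-elim (ℕₚ.<-irrefl refl (injective⇒≤ {f = squeeze}
                  (λ eq → φ-inj _ _ (punchOut-injective {i = u} _ _ eq))))
  where
  -- Were u missed, punching it out of the image would inject Fin (1 + s) into Fin s.
  squeeze : Fin (suc s) → Fin s
  squeeze a = punchOut {i = u} (λ u≡φa → miss (a , sym u≡φa))

iso-id : ∀ {n} (H : Graph n) → IsIso H H (Vec.allFin n)
iso-id H =
  (λ a b eq → trans (sym (Vecₚ.lookup-allFin a)) (trans eq (Vecₚ.lookup-allFin b))) ,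
  (λ u → u , Vecₚ.lookup-allFin u) ,
  (λ a b → sym (cong₂ (adj H) (Vecₚ.lookup-allFin a) (Vecₚ.lookup-allFin b)))

iso-∘ : ∀ {m m' m''} {H : Graph m} {H' : Graph m'} {H'' : Graph m''} {φ ψ} →
  IsIso H H' φ → IsIso H' H'' ψ → IsIso H H'' (ψ ∘ᵛ φ)
iso-∘ {H'' = H''} {φ} {ψ} (φ-inj , φ-surj , φ-adj) (ψ-inj , ψ-surj , ψ-adj) =
  (λ a b eq → φ-inj a b (ψ-inj _ _ (trans (sym (lookup-∘ᵛ ψ φ a)) (trans eq (lookup-∘ᵛ ψ φ b))))) ,
  (λ u → let (b , ψb≡u) = ψ-surj u ; (a , φa≡b) = φ-surj b
         in a , trans (lookup-∘ᵛ ψ φ a) (trans (cong (lookup ψ) φa≡b) ψb≡u)) ,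
  (λ a b → trans (φ-adj a b) (trans (ψ-adj _ _)
             (sym (cong₂ (adj H'') (lookup-∘ᵛ ψ φ a) (lookup-∘ᵛ ψ φ b)))))

iso-inverse : ∀ {m n} {H : Graph m} {G : Graph n} {φ} → IsIso H G φ →
  Σ (Vec (Fin m) n) λ σ → IsIso G H σ × (∀ a → lookup σ (lookup φ a) ≡ a)
iso-inverse {H = H} {G} {φ} (φ-inj , φ-surj , φ-adj) = σ , (σ-inj , σ-surj , σ-adj) , σφ
  where
  σ = tabulate (λ b → proj₁ (φ-surj b))
  φσ : ∀ b → lookup φ (lookup σ b) ≡ b
  φσ b = trans (cong (lookup φ) (Vecₚ.lookup∘tabulate _ b)) (proj₂ (φ-surj b))
  σφ : ∀ a → lookup σ (lookup φ a) ≡ a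
  σφ a = φ-inj _ _ (φσ (lookup φ a))
  σ-inj : Injective σ
  σ-inj b b' eq = trans (sym (φσ b)) (trans (cong (lookup φ) eq) (φσ b'))
  σ-surj : ∀ a → ∃ λ b → lookup σ b ≡ a
  σ-surj a = lookup φ a , σφ a
  σ-adj : ∀ b b' → adj G b b' ≡ adj H (lookup σ b) (lookup σ b')
  σ-adj b b' = trans (sym (cong₂ (adj G) (φσ b) (φσ b'))) (sym (φ-adj _ _))

orbit-connects : ∀ {n} {H : Graph n} {r u u'} → Orbit H r u → Orbit H r u' →
  ∃ λ δ → IsIso H H δ × lookup δ u ≡ u'
orbit-connects {H = H} {u = u} (α , α-iso , αr≡u) (β , β-iso , βr≡u')
  with iso-inverse {H = H} {G = H} {φ = α} α-iso
... | α⁻¹ , α⁻¹-iso , α⁻¹α = β ∘ᵛ α⁻¹ , iso-∘ {H = H} {H} {H} {α⁻¹} {β} α⁻¹-iso β-iso ,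
  trans (lookup-∘ᵛ β α⁻¹ u) (trans (cong (λ x → lookup β (lookup α⁻¹ x)) (sym αr≡u))
    (trans (cong (lookup β) (α⁻¹α _)) βr≡u'))

IsIsoInduced : ∀ {m n} → Graph m → Graph n → Vec Bool n → Vec (Fin n) m → Set
IsIsoInduced {m} {n} H G S θ =
  Injective θ ×
  (∀ (a : Fin m) → lookup S (lookup θ a) ≡ true) ×
  (∀ (x : Fin n) → lookup S x ≡ true → ∃ λ (a : Fin m) → lookup θ a ≡ x) ×
  (∀ (a b : Fin m) → adj H a b ≡ adj G (lookup θ a) (lookup θ b))

isIsoInduced-∘ : ∀ {m m' n} {H : Graph m} {H' : Graph m'} {G : Graph n} {S φ θ} →
  IsIso H H' φ → IsIsoInduced H' G S θ → IsIsoInduced H G S (θ ∘ᵛ φ)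
isIsoInduced-∘ {G = G} {S} {φ} {θ} (φ-inj , φ-surj , φ-adj) (θ-inj , θ-in , θ-onto , θ-adj) =
  (λ a b eq → φ-inj a b (θ-inj _ _ (trans (sym (lookup-∘ᵛ θ φ a)) (trans eq (lookup-∘ᵛ θ φ b))))) ,
  (λ a → subst (λ x → lookup S x ≡ true) (sym (lookup-∘ᵛ θ φ a)) (θ-in _)) ,
  (λ x x∈S → let (b , θb≡x) = θ-onto x x∈S ; (a , φa≡b) = φ-surj b
             in a , trans (lookup-∘ᵛ θ φ a) (trans (cong (lookup θ) φa≡b) θb≡x)) ,
  (λ a b → trans (φ-adj a b) (trans (θ-adj _ _)
             (sym (cong₂ (adj G) (lookup-∘ᵛ θ φ a) (lookup-∘ᵛ θ φ b)))))

isIsoInduced-unique : ∀ {m m' n} {H : Graph m} {H' : Graph m'} {G : Graph n} {S θ θ'} →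
  IsIsoInduced H G S θ → IsIsoInduced H' G S θ' →
  Σ (Vec (Fin m') m) λ ρ → IsIso H H' ρ × (∀ a → lookup θ' (lookup ρ a) ≡ lookup θ a)
isIsoInduced-unique {H = H} {H'} {G} {θ = θ} {θ'} (θ-inj , θ-in , θ-onto , θ-adj)
                                             (θ'-inj , θ'-in , θ'-onto , θ'-adj) =
  ρ , (ρ-inj , ρ-surj , ρ-adj) , θ'ρ
  where
  ρ = tabulate (λ a → proj₁ (θ'-onto (lookup θ a) (θ-in a)))
  θ'ρ : ∀ a → lookup θ' (lookup ρ a) ≡ lookup θ a
  θ'ρ a = trans (cong (lookup θ') (Vecₚ.lookup∘tabulate _ a)) (proj₂ (θ'-onto (lookup θ a) (θ-in a)))
  ρ-inj : Injective ρ
  ρ-inj a b eq = θ-inj a b (trans (sym (θ'ρ a)) (trans (cong (lookup θ') eq) (θ'ρ b)))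
  ρ-surj : ∀ c → ∃ λ a → lookup ρ a ≡ c
  ρ-surj c with θ-onto (lookup θ' c) (θ'-in c)
  ... | a , θa≡θ'c = a , θ'-inj _ _ (trans (θ'ρ a) θa≡θ'c)
  ρ-adj : ∀ a b → adj H a b ≡ adj H' (lookup ρ a) (lookup ρ b)
  ρ-adj a b = trans (θ-adj a b) (trans (sym (cong₂ (adj G) (θ'ρ a) (θ'ρ b))) (sym (θ'-adj _ _)))

iso⇒isIsoInduced : ∀ {m n} {H : Graph m} {G : Graph n} {φ} → IsIso H G φ → IsIsoInduced H G full φ
iso⇒isIsoInduced {φ = φ} (φ-inj , φ-surj , φ-adj) =
  φ-inj , (λ a → lookup-full (lookup φ a)) , (λ x _ → φ-surj x) , φ-adj

isoSub-full : ∀ {s} {K : Graph s} {S E φ} → IsIsoSub K S E φ → ∀ x → lookup S x ≡ true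
isoSub-full {φ = φ} (φ-inj , φ-in , _) x with injective⇒surjective φ φ-inj x
... | a , refl = φ-in a

true≢false : true ≢ false
true≢false ()

module _ {n} (G : Graph n) where

  subgraph-absent : ∀ {S E x y} → IsSubgraph G S E →
    (lookup S x ≡ true → lookup S y ≡ true → ⊥) → E[ E , x , y ] ≡ false
  subgraph-absent {E = E} {x} {y} (E⊆G , _) outside with E[ E , x , y ] in e
  ... | false = refl
  ... | true = ⊥-elim (outside (proj₁ (proj₂ (E⊆G x y e))) (proj₂ (proj₂ (E⊆G x y e))))

  inducedEdges : Vec Bool n → Edges n
  inducedEdges S = tabulate (λ x → tabulate (λ y → (lookup S x ∧ lookup S y) ∧ adj G x y))

  lookup-inducedEdges : ∀ S x y → E[ inducedEdges S , x , y ] ≡ (lookup S x ∧ lookup S y) ∧ adj G x y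
  lookup-inducedEdges S = lookup-tabulate₂ _

  inducedEdges-inside : ∀ S {x y} → lookup S x ≡ true → lookup S y ≡ true →
    E[ inducedEdges S , x , y ] ≡ adj G x y
  inducedEdges-inside S {x} {y} x∈S y∈S =
    trans (lookup-inducedEdges S x y) (cong₂ (λ a b → (a ∧ b) ∧ adj G x y) x∈S y∈S)

  inducedEdges-isSubgraph : ∀ S → IsSubgraph G S (inducedEdges S)
  inducedEdges-isSubgraph S = inside , symmetric
    where
    inside : ∀ x y → E[ inducedEdges S , x , y ] ≡ true →
      adj G x y ≡ true × lookup S x ≡ true × lookup S y ≡ true
    inside x y e = ∧-conicalʳ (lookup S x ∧ lookup S y) (adj G x y) e' ,
                   ∧-conicalˡ (lookup S x) (lookup S y) x,y∈S ,
                   ∧-conicalʳ (lookup S x) (lookup S y) x,y∈S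
      where
      e' = trans (sym (lookup-inducedEdges S x y)) e
      x,y∈S = ∧-conicalˡ (lookup S x ∧ lookup S y) (adj G x y) e'
    symmetric : ∀ x y → E[ inducedEdges S , x , y ] ≡ E[ inducedEdges S , y , x ]
    symmetric x y = trans (lookup-inducedEdges S x y)
      (trans (cong₂ _∧_ (∧-comm (lookup S x) (lookup S y)) (Graph.sym G x y))
             (sym (lookup-inducedEdges S y x)))

  inducedEdges-unique : ∀ {S E} → IsSubgraph G S E → IsInduced G S E → E ≡ inducedEdges S
  inducedEdges-unique {S} {E} E-sub E-induced = edges-ext entry
    where
    outside : ∀ {x y} → (lookup S x ≡ true → lookup S y ≡ true → ⊥) →
      E[ E , x , y ] ≡ E[ inducedEdges S , x , y ]
    outside ∉S = trans (subgraph-absent {S = S} {E} E-sub ∉S)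
                       (sym (subgraph-absent {S = S} {inducedEdges S} (inducedEdges-isSubgraph S) ∉S))
    entry : ∀ x y → E[ E , x , y ] ≡ E[ inducedEdges S , x , y ]
    entry x y with lookup S x in x∈S | lookup S y in y∈S
    ... | true  | true  = trans (E-induced x y x∈S y∈S) (sym (inducedEdges-inside S x∈S y∈S))
    ... | true  | false = outside (λ _ y∈S' → true≢false (trans (sym y∈S') y∈S))
    ... | false | _     = outside (λ x∈S' _ → true≢false (trans (sym x∈S') x∈S))

Placement : ∀ {m n} → Graph m → Fin m → Graph n → Fin n → Vec Bool n → Vec (Fin n) m → Set
Placement H r G v S θ = IsIsoInduced H G S θ × ∃ λ u → Orbit H r u × lookup θ u ≡ v

placement⇒inducedOccurrence : ∀ {m n} {H : Graph m} {r} {G : Graph n} {v S θ} →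
  Placement H r G v S θ → InducedOccurrence H r G v (S , inducedEdges G S)
placement⇒inducedOccurrence {G = G} {S = S} {θ} ((θ-inj , θ-in , θ-onto , θ-adj) , θ-root) =
  ( inducedEdges-isSubgraph G S
  , θ , (θ-inj , θ-in , θ-onto ,
         λ a b → trans (θ-adj a b) (sym (inducedEdges-inside G S (θ-in a) (θ-in b))))
  , θ-root )
  , λ x y → inducedEdges-inside G S

inducedOccurrence⇒placement : ∀ {m n} {H : Graph m} {r} {G : Graph n} {v S E} →
  InducedOccurrence H r G v (S , E) → ∃ λ θ → Placement H r G v S θ
inducedOccurrence⇒placement ((_ , θ , (θ-inj , θ-in , θ-onto , θ-adj) , θ-root) , E-induced) =
  θ , (θ-inj , θ-in , θ-onto , λ a b → trans (θ-adj a b) (E-induced _ _ (θ-in a) (θ-in b))) , θ-root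

module _ {s n} (X : Graphlet s) (G : Graph n) (v : Fin n) (n<s : n < s) where

  private
    no-room : ∀ {S E} → ¬ Occurrence (graph X) (root X) G v (S , E)
    no-room (_ , φ , (φ-inj , _) , _) = ℕₚ.<⇒≱ n<s (injective⇒≤ (λ {a} {b} → φ-inj a b))

  grossCount-larger : grossCount X G v ≡ 0
  grossCount-larger = count-none _ (candidates n) λ { (S , E) → no-room {S} {E} }

  netCount-larger : netCount X G v ≡ 0
  netCount-larger = count-none _ (candidates n) λ { (S , E) → no-room {S} {E} ∘ proj₁ }

vertexPairs : ∀ s → List (Fin s × Fin s)
vertexPairs s = cartesianProduct (allFin s) (allFin s)

vertexPairs-enumerate : ∀ s → Enumerates (vertexPairs s)
vertexPairs-enumerate s = cartesianProduct⁺ (allFin⁺ s) (allFin⁺ s) ,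
  λ { (a , b) → ∈-cartesianProduct⁺ (∈-allFin a) (∈-allFin b) }

isEdge? : ∀ {s} (K : Graph s) → Decidable (λ (p : Fin s × Fin s) → adj K (proj₁ p) (proj₂ p) ≡ true)
isEdge? K (a , b) = adj K a b ≟ᴮ true

edgeCount : ∀ {s} → Graph s → ℕ
edgeCount {s} K = count (isEdge? K) (vertexPairs s)

-- An occurrence of K in a graph H of the same size uses every vertex of H, so it is either
-- all of H or misses an edge of H.
same-size-occurrence : ∀ {s} {K H : Graph s} {S E φ} → IsSubgraph H S E → IsIsoSub K S E φ →
  (IsIso K H φ × (∀ x y → E[ E , x , y ] ≡ adj H x y)) ⊎ edgeCount K < edgeCount H
same-size-occurrence {s} {K} {H} {S} {E} {φ} (E⊆H , _) (φ-inj , _ , _ , φ-adj)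
  with all? (λ x → all? (λ y → E[ E , x , y ] ≟ᴮ adj H x y))
... | yes E≗H =
  inj₁ ((φ-inj , injective⇒surjective φ φ-inj , λ a b → trans (φ-adj a b) (E≗H _ _)) , E≗H)
... | no E≉H with ¬∀⟶∃¬ s _ (λ x → all? (λ y → E[ E , x , y ] ≟ᴮ adj H x y)) E≉H
...   | x , row≉ with ¬∀⟶∃¬ s _ (λ y → E[ E , x , y ] ≟ᴮ adj H x y) row≉
...     | y , Exy≢Hxy = inj₂ (count-<-injection (Product.≡-dec _≟ᶠ_ _≟ᶠ_) (isEdge? K) (isEdge? H)
                          image preserves image-injective (proj₁ (vertexPairs-enumerate s))
                          (proj₂ (vertexPairs-enumerate s)) (x , y) (proj₂ missing) misses)
  where
  image : Fin s × Fin s → Fin s × Fin s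
  image (a , b) = lookup φ a , lookup φ b
  preserves : ∀ p → adj K (proj₁ p) (proj₂ p) ≡ true →
    adj H (proj₁ (image p)) (proj₂ (image p)) ≡ true
  preserves (a , b) e = proj₁ (E⊆H _ _ (trans (sym (φ-adj a b)) e))
  image-injective : ∀ p q → _ → _ → image p ≡ image q → p ≡ q
  image-injective (a , b) (c , d) _ _ eq =
    cong₂ _,_ (φ-inj a c (cong proj₁ eq)) (φ-inj b d (cong proj₂ eq))
  missing : E[ E , x , y ] ≡ false × adj H x y ≡ true
  missing with E[ E , x , y ] in e | adj H x y in h
  ... | false | true  = refl , refl
  ... | false | false = ⊥-elim (Exy≢Hxy refl)
  ... | true  | true  = ⊥-elim (Exy≢Hxy refl)
  ... | true  | false = ⊥-elim (true≢false (trans (sym (proj₁ (E⊆H x y e))) h))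
  misses : ∀ p → adj K (proj₁ p) (proj₂ p) ≡ true → image p ≢ (x , y)
  misses (a , b) e eq = true≢false (trans (sym e) (trans (φ-adj a b)
    (trans (cong₂ (λ u w → E[ E , u , w ]) (cong proj₁ eq) (cong proj₂ eq)) (proj₁ missing))))

grossCount-self : ∀ {s} (X : Graphlet s) {w} → Orbit (graph X) (root X) w →
  grossCount X (graph X) w ≡ 1
grossCount-self {s} X {w} w∈orbit =
  count≡1 (Occurrence? K (root X) K w) (proj₁ (candidates-enumerate s))
    (proj₂ (candidates-enumerate s) whole) (proj₁ whole-occurrence) only-whole
  where
  K = graph X
  whole = full , inducedEdges K full
  whole-occurrence : InducedOccurrence K (root X) K w whole
  whole-occurrence = placement⇒inducedOccurrence {H = K} {G = K} {S = full} {θ = Vec.allFin s}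
    (iso⇒isIsoInduced {H = K} {G = K} {Vec.allFin s} (iso-id K) , w , w∈orbit , Vecₚ.lookup-allFin w)
  only-whole : ∀ p → Occurrence K (root X) K w p → p ≡ whole
  only-whole (S , E) (E⊆K , φ , φ-isoSub , _)
    with same-size-occurrence {K = K} {K} {S} {E} {φ} E⊆K φ-isoSub
  ... | inj₂ fewer = ⊥-elim (ℕₚ.<-irrefl refl fewer)
  ... | inj₁ (_ , E≗K) = cong₂ _,_
    (lookup-ext (λ x → trans (isoSub-full {K = K} {S} {E} {φ} φ-isoSub x) (sym (lookup-full x))))
    (edges-ext λ x y →
      trans (E≗K x y) (sym (inducedEdges-inside K full (lookup-full x) (lookup-full y))))

occurrence-same-size : ∀ {s} (X Y : Graphlet s) {w S E} → Orbit (graph Y) (root Y) w →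
  Occurrence (graph X) (root X) (graph Y) w (S , E) →
  GraphletIso X Y ⊎ edgeCount (graph X) < edgeCount (graph Y)
occurrence-same-size X Y {w} {S} {E} w∈orbit (E⊆Y , φ , φ-isoSub , u , (α , α-iso , αr≡u) , φu≡w)
  with same-size-occurrence {K = graph X} {graph Y} {S} {E} {φ} E⊆Y φ-isoSub
... | inj₂ fewer = inj₂ fewer
... | inj₁ (φ-iso , _) = inj₁ (φ ∘ᵛ α , iso-∘ {H = graph X} {graph X} {graph Y} {α} {φ} α-iso φ-iso ,
  subst (Orbit (graph Y) (root Y))
    (sym (trans (lookup-∘ᵛ φ α (root X)) (trans (cong (lookup φ) αr≡u) φu≡w))) w∈orbit)

pullback : ∀ {s n} → Graph n → Vec (Fin n) s → Graph s
pullback G φ = record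
  { adj = λ a b → adj G (lookup φ a) (lookup φ b)
  ; sym = λ a b → Graph.sym G _ _
  ; irrefl = λ a → Graph.irrefl G _
  }

reach-mono : ∀ {s} {K L : Graph s} → (∀ a b → adj K a b ≡ true → adj L a b ≡ true) →
  ∀ {a b} → Reach K a b → Reach L a b
reach-mono K⊆L here = here
reach-mono K⊆L (step e path) = step (K⊆L _ _ e) (reach-mono K⊆L path)

-- The subgraph induced on the vertex set of an occurrence of a connected graph is connected,
-- so it is a graphlet.
inducedClass-exists : ∀ {s N n} {R : Fin N → Graphlet s} → (∀ Y → ∃ λ k → GraphletIso Y (R k)) →
  ∀ (X : Graphlet s) {G : Graph n} {v S E} → Occurrence (graph X) (root X) G v (S , E) →
  ∃ λ k → InducedOccurrence (graph (R k)) (root (R k)) G v (S , inducedEdges G S)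
inducedClass-exists {R = R} classify X {G} {v} {S}
                    ((E⊆G , _) , φ , (φ-inj , φ-in , φ-onto , φ-adj) , u , u∈orbit , φu≡v) =
  classified (classify Y)
  where
  Y : Graphlet _
  Y = record
    { graph = pullback G φ
    ; connected = λ a b →
        reach-mono (λ a b e → proj₁ (E⊆G _ _ (trans (sym (φ-adj a b)) e))) (connected X a b)
    ; root = u
    }
  classified : (∃ λ k → GraphletIso Y (R k)) →
    ∃ λ k → InducedOccurrence (graph (R k)) (root (R k)) G v (S , inducedEdges G S)
  classified (k , ρ , ρ-iso , ρu∈orbit) with iso-inverse {H = graph Y} {G = graph (R k)} {φ = ρ} ρ-iso
  ... | σ , σ-iso , σρ = k , placement⇒inducedOccurrence {H = graph (R k)} {G = G} {S = S} {φ ∘ᵛ σ}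
    ( isIsoInduced-∘ {H = graph (R k)} {graph Y} {G} {S} {σ} {φ} σ-iso
        (φ-inj , φ-in , φ-onto , λ a b → refl)
    , lookup ρ u , ρu∈orbit , trans (lookup-∘ᵛ φ σ _) (trans (cong (lookup φ) (σρ u)) φu≡v))

inducedClass-unique : ∀ {s N n} {R : Fin N → Graphlet s} → (∀ i j → GraphletIso (R i) (R j) → i ≡ j) →
  ∀ {k k'} {G : Graph n} {v S E} →
  InducedOccurrence (graph (R k)) (root (R k)) G v (S , E) →
  InducedOccurrence (graph (R k')) (root (R k')) G v (S , E) → k ≡ k'
inducedClass-unique {R = R} R-distinct {k} {k'} {G} {v} {S} {E} occ occ'
  with inducedOccurrence⇒placement {H = graph (R k)} {root (R k)} {G} {v} {S} {E} occ
     | inducedOccurrence⇒placement {H = graph (R k')} {root (R k')} {G} {v} {S} {E} occ'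
... | θ , θ-iso , u , (α , α-iso , αr≡u) , θu≡v | θ' , θ'-iso , u' , u'∈orbit , θ'u'≡v
  with isIsoInduced-unique {H = graph (R k)} {graph (R k')} {G} {S} {θ} {θ'} θ-iso θ'-iso
... | ρ , ρ-iso , θ'ρ≡θ = R-distinct k k'
  ( ρ ∘ᵛ α , iso-∘ {H = graph (R k)} {graph (R k)} {graph (R k')} {α} {ρ} α-iso ρ-iso
  , subst (Orbit (graph (R k')) (root (R k'))) (sym ρα-root) u'∈orbit )
  where
  ρα-root : lookup (ρ ∘ᵛ α) (root (R k)) ≡ u'
  ρα-root = trans (lookup-∘ᵛ ρ α _) (trans (cong (lookup ρ) αr≡u)
    (proj₁ θ'-iso _ _ (trans (θ'ρ≡θ u) (trans θu≡v (sym θ'u'≡v)))))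

-- Transport of occurrences along an induced isomorphism

module _ {s n} {H : Graph s} {G : Graph n} {S₀ : Vec Bool n} {θ : Vec (Fin n) s}
         (θ-iso : IsIsoInduced H G S₀ θ) where

  private
    θ-inj = proj₁ θ-iso
    θ-in = proj₁ (proj₂ θ-iso)
    θ-onto = proj₁ (proj₂ (proj₂ θ-iso))
    θ-adj = proj₂ (proj₂ (proj₂ θ-iso))

    Preimage : Fin n → Set
    Preimage x = ∃ λ a → lookup θ a ≡ x

    preimage? : ∀ x → Dec (Preimage x)
    preimage? x = any? (λ a → lookup θ a ≟ᶠ x)

    pushEntry : Edges s → ∀ {x y} → Dec (Preimage x) → Dec (Preimage y) → Bool
    pushEntry E (yes (a , _)) (yes (b , _)) = E[ E , a , b ]
    pushEntry E _ _ = false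

    push : Edges s → Edges n
    push E = tabulate (λ x → tabulate (λ y → pushEntry E (preimage? x) (preimage? y)))

    pull : Edges n → Edges s
    pull E = tabulate (λ a → tabulate (λ b → E[ E , lookup θ a , lookup θ b ]))

    lookup-push : ∀ E x y → E[ push E , x , y ] ≡ pushEntry E (preimage? x) (preimage? y)
    lookup-push E = lookup-tabulate₂ (λ x y → pushEntry E (preimage? x) (preimage? y))

    lookup-pull : ∀ E a b → E[ pull E , a , b ] ≡ E[ E , lookup θ a , lookup θ b ]
    lookup-pull E = lookup-tabulate₂ (λ a b → E[ E , lookup θ a , lookup θ b ])

    push-θ : ∀ E a b → E[ push E , lookup θ a , lookup θ b ] ≡ E[ E , a , b ]
    push-θ E a b = trans (lookup-push E _ _) (entry (preimage? (lookup θ a)) (preimage? (lookup θ b)))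
      where
      entry : (da : Dec (Preimage (lookup θ a))) (db : Dec (Preimage (lookup θ b))) →
        pushEntry E da db ≡ E[ E , a , b ]
      entry (yes (c , θc≡θa)) (yes (d , θd≡θb)) =
        cong₂ (λ u w → E[ E , u , w ]) (θ-inj c a θc≡θa) (θ-inj d b θd≡θb)
      entry (yes _) (no ∄b) = ⊥-elim (∄b (b , refl))
      entry (no ∄a) _ = ⊥-elim (∄a (a , refl))

    push-true : ∀ E {x y} → E[ push E , x , y ] ≡ true →
      ∃ λ a → ∃ λ b → lookup θ a ≡ x × lookup θ b ≡ y × E[ E , a , b ] ≡ true
    push-true E {x} {y} e = entry (preimage? x) (preimage? y) (trans (sym (lookup-push E x y)) e)
      where
      entry : (dx : Dec (Preimage x)) (dy : Dec (Preimage y)) → pushEntry E dx dy ≡ true →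
        ∃ λ a → ∃ λ b → lookup θ a ≡ x × lookup θ b ≡ y × E[ E , a , b ] ≡ true
      entry (yes (a , θa≡x)) (yes (b , θb≡y)) e = a , b , θa≡x , θb≡y , e

    push-sym : ∀ E → (∀ a b → E[ E , a , b ] ≡ E[ E , b , a ]) →
      ∀ x y → E[ push E , x , y ] ≡ E[ push E , y , x ]
    push-sym E E-sym x y = trans (lookup-push E x y)
      (trans (entry (preimage? x) (preimage? y)) (sym (lookup-push E y x)))
      where
      entry : (dx : Dec (Preimage x)) (dy : Dec (Preimage y)) → pushEntry E dx dy ≡ pushEntry E dy dx
      entry (yes (a , _)) (yes (b , _)) = E-sym a b
      entry (yes _) (no _) = refl
      entry (no _) (yes _) = refl
      entry (no _) (no _) = refl

    push-pull : ∀ {E} → IsSubgraph G S₀ E → push (pull E) ≡ E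
    push-pull {E} E⊆G =
      edges-ext (λ x y → trans (lookup-push (pull E) x y) (entry (preimage? x) (preimage? y)))
      where
      outside : ∀ {x y} → ¬ Preimage x ⊎ ¬ Preimage y → false ≡ E[ E , x , y ]
      outside {x} {y} ∄ = sym (subgraph-absent G {S₀} {E} E⊆G λ x∈S₀ y∈S₀ → case ∄ x∈S₀ y∈S₀)
        where
        case : ¬ Preimage x ⊎ ¬ Preimage y → _ → _ → ⊥
        case (inj₁ ∄x) x∈S₀ _ = ∄x (θ-onto x x∈S₀)
        case (inj₂ ∄y) _ y∈S₀ = ∄y (θ-onto y y∈S₀)
      entry : ∀ {x y} (dx : Dec (Preimage x)) (dy : Dec (Preimage y)) →
        pushEntry (pull E) dx dy ≡ E[ E , x , y ]
      entry (yes (a , refl)) (yes (b , refl)) = lookup-pull E a b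
      entry (yes _) (no ∄y) = outside (inj₂ ∄y)
      entry (no ∄x) _ = outside (inj₁ ∄x)

  module _ {K : Graph s} {r w : Fin s} {v : Fin n} (θw≡v : lookup θ w ≡ v) where

    private
      push-occurrence : ∀ {S E} → Occurrence K r H w (S , E) → Occurrence K r G v (S₀ , push E)
      push-occurrence {S} {E}
        ((E⊆H , E-sym) , φ , (φ-inj , φ-in , φ-onto , φ-adj) , u , u∈orbit , φu≡w) =
        (inside , push-sym E E-sym) , θ ∘ᵛ φ , (θφ-inj , θφ-in , θφ-onto , θφ-adj) ,
        u , u∈orbit , trans (lookup-∘ᵛ θ φ u) (trans (cong (lookup θ) φu≡w) θw≡v)
        where
        inside : ∀ x y → E[ push E , x , y ] ≡ true →
          adj G x y ≡ true × lookup S₀ x ≡ true × lookup S₀ y ≡ true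
        inside x y e with push-true E e
        ... | a , b , refl , refl , e' =
          trans (sym (θ-adj a b)) (proj₁ (E⊆H a b e')) , θ-in a , θ-in b
        θφ-inj : Injective (θ ∘ᵛ φ)
        θφ-inj a b eq =
          φ-inj a b (θ-inj _ _ (trans (sym (lookup-∘ᵛ θ φ a)) (trans eq (lookup-∘ᵛ θ φ b))))
        θφ-in : ∀ a → lookup S₀ (lookup (θ ∘ᵛ φ) a) ≡ true
        θφ-in a = subst (λ x → lookup S₀ x ≡ true) (sym (lookup-∘ᵛ θ φ a)) (θ-in _)
        θφ-onto : ∀ x → lookup S₀ x ≡ true → ∃ λ a → lookup (θ ∘ᵛ φ) a ≡ x
        θφ-onto x x∈S₀ with θ-onto x x∈S₀
        ... | c , refl with injective⇒surjective φ φ-inj c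
        ...   | a , refl = a , lookup-∘ᵛ θ φ a
        θφ-adj : ∀ a b → adj K a b ≡ E[ push E , lookup (θ ∘ᵛ φ) a , lookup (θ ∘ᵛ φ) b ]
        θφ-adj a b = trans (φ-adj a b) (trans (sym (push-θ E _ _))
          (sym (cong₂ (λ x y → E[ push E , x , y ]) (lookup-∘ᵛ θ φ a) (lookup-∘ᵛ θ φ b))))

      pull-occurrence : ∀ {E} → Occurrence K r G v (S₀ , E) → Occurrence K r H w (full , pull E)
      pull-occurrence {E} ((E⊆G , E-sym) , φ , (φ-inj , φ-in , φ-onto , φ-adj) , u , u∈orbit , φu≡v) =
        (inside , symmetric) , φ' , (φ'-inj , (λ a → lookup-full (lookup φ' a)) , φ'-onto , φ'-adj) ,
        u , u∈orbit , θ-inj _ _ (trans (θφ' u) (trans φu≡v (sym θw≡v)))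
        where
        φ' = tabulate (λ a → proj₁ (θ-onto (lookup φ a) (φ-in a)))
        θφ' : ∀ a → lookup θ (lookup φ' a) ≡ lookup φ a
        θφ' a = trans (cong (lookup θ) (Vecₚ.lookup∘tabulate _ a))
                      (proj₂ (θ-onto (lookup φ a) (φ-in a)))
        inside : ∀ a b → E[ pull E , a , b ] ≡ true →
          adj H a b ≡ true × lookup full a ≡ true × lookup full b ≡ true
        inside a b e = trans (θ-adj a b) (proj₁ (E⊆G _ _ (trans (sym (lookup-pull E a b)) e))) ,
                       lookup-full a , lookup-full b
        symmetric : ∀ a b → E[ pull E , a , b ] ≡ E[ pull E , b , a ]
        symmetric a b = trans (lookup-pull E a b) (trans (E-sym _ _) (sym (lookup-pull E b a)))
        φ'-inj : Injective φ'
        φ'-inj a b eq = φ-inj a b (trans (sym (θφ' a)) (trans (cong (lookup θ) eq) (θφ' b)))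
        φ'-onto : ∀ c → lookup full c ≡ true → ∃ λ a → lookup φ' a ≡ c
        φ'-onto c _ with φ-onto (lookup θ c) (θ-in c)
        ... | a , φa≡θc = a , θ-inj _ _ (trans (θφ' a) φa≡θc)
        φ'-adj : ∀ a b → adj K a b ≡ E[ pull E , lookup φ' a , lookup φ' b ]
        φ'-adj a b = trans (φ-adj a b) (trans (sym (cong₂ (λ x y → E[ E , x , y ]) (θφ' a) (θφ' b)))
          (sym (lookup-pull E _ _)))

      pull-push : ∀ {S E} → Occurrence K r H w (S , E) → (full , pull (push E)) ≡ (S , E)
      pull-push {S} {E} (_ , φ , φ-isoSub , _) = cong₂ _,_
        (lookup-ext (λ x → trans (lookup-full x) (sym (isoSub-full {K = K} {S} {E} {φ} φ-isoSub x))))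
        (edges-ext (λ a b → trans (lookup-pull (push E) a b) (push-θ E a b)))

    transport : count (Occurrence? K r H w) (candidates s)
      ≡ count (λ p → Occurrence? K r G v p ×-dec (proj₁ p ≟ⱽ S₀)) (candidates n)
    transport = count-bijection _≟ᶜ_ _≟ᶜ_ _ _ (candidates-enumerate s) (candidates-enumerate n)
      (λ p → S₀ , push (proj₂ p)) (λ p → full , pull (proj₂ p))
      (λ { (S , E) occ → push-occurrence {S} {E} occ , refl })
      (λ { (S , E) (occ , refl) → pull-occurrence {E} occ })
      (λ { (S , E) occ → pull-push {S} {E} occ })
      (λ { (S , E) ((E⊆G , _) , refl) → cong (S₀ ,_) (push-pull E⊆G) })

grossCount-on-placement : ∀ {s n} (X Y : Graphlet s) {w} → Orbit (graph Y) (root Y) w →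
  ∀ {G : Graph n} {v S θ} → Placement (graph Y) (root Y) G v S θ →
  grossCount X (graph Y) w
    ≡ count (λ p → Occurrence? (graph X) (root X) G v p ×-dec (proj₁ p ≟ⱽ S)) (candidates n)
grossCount-on-placement X Y {w} w∈orbit {G} {v} {S} {θ} (θ-iso , u , u∈orbit , θu≡v)
  with orbit-connects {H = graph Y} w∈orbit u∈orbit
... | δ , δ-iso , δw≡u =
  transport {H = graph Y} {G} {S} {θ ∘ᵛ δ}
    (isIsoInduced-∘ {H = graph Y} {graph Y} {G} {S} {δ} {θ} δ-iso θ-iso)
    {K = graph X} {root X} {w} {v}
    (trans (lookup-∘ᵛ θ δ w) (trans (cong (lookup θ) δw≡u) θu≡v))

module _ {s N} {R : Fin N → Graphlet s} (R-enum : IsGraphletEnumeration s N R)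
         {vR : Fin N → Fin s} (vR-orbit : ∀ k → Orbit (graph (R k)) (root (R k)) (vR k))
         (X : Graphlet s) {n} (G : Graph n) (v : Fin n) where

  private
    cands = candidates n
    cands-unique = proj₁ (candidates-enumerate n)
    cands-complete = proj₂ (candidates-enumerate n)

    Occ? : Decidable (Occurrence (graph X) (root X) G v)
    Occ? = Occurrence? (graph X) (root X) G v

    IndOcc : Fin N → Candidate n → Set
    IndOcc k = InducedOccurrence (graph (R k)) (root (R k)) G v

    IndOcc? : ∀ k → Decidable (IndOcc k)
    IndOcc? k = InducedOccurrence? (graph (R k)) (root (R k)) G v

    closure : Candidate n → Candidate n
    closure p = proj₁ p , inducedEdges G (proj₁ p)

    g : Fin N → ℕ
    g k = grossCount X (graph (R k)) (vR k)

    one-class : ∀ p → Occurrence (graph X) (root X) G v p →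
      count (λ k → IndOcc? k (closure p)) (allFin N) ≡ 1
    one-class (S , E) occ with inducedClass-exists {R = R} (proj₁ R-enum) X {G} {v} {S} {E} occ
    ... | k , ind-occ = count≡1 (λ k → IndOcc? k (closure (S , E))) (allFin⁺ N) (∈-allFin k) ind-occ
      (λ k' ind-occ' → inducedClass-unique {R = R} (proj₂ R-enum) {k'} {k} {G} {v} {S}
                         {inducedEdges G S} ind-occ' ind-occ)

    one-closure : ∀ p → count (λ q → closure p ≟ᶜ q) cands ≡ 1
    one-closure p = count≡1 (λ q → closure p ≟ᶜ q) cands-unique (cands-complete (closure p)) refl
                      (λ q eq → sym eq)

    on-class : ∀ {k} q → IndOcc k q →
      count (λ p → (Occ? p ×-dec IndOcc? k (closure p)) ×-dec (closure p ≟ᶜ q)) cands ≡ g k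
    on-class {k} (S , E) ind-occ = trans
      (count-cong _ _ (λ p ((occ , _) , closure≡q) → occ , cong proj₁ closure≡q)
                      (λ p (occ , S≡) →
                        (occ , subst (IndOcc k) (sym (closure≡ p S≡)) ind-occ) , closure≡ p S≡)
                      cands)
      (sym (grossCount-on-placement X (R k) (vR-orbit k) {G} {v} {S} {proj₁ placed} (proj₂ placed)))
      where
      placed = inducedOccurrence⇒placement {H = graph (R k)} {root (R k)} {G} {v} {S} {E} ind-occ
      E≡ : E ≡ inducedEdges G S
      E≡ = inducedEdges-unique G {S} {E} (proj₁ (proj₁ ind-occ)) (proj₂ ind-occ)
      closure≡ : ∀ p → proj₁ p ≡ S → closure p ≡ (S , E)
      closure≡ p refl = cong (S ,_) (sym E≡)

    off-class : ∀ {k} q → ¬ IndOcc k q →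
      count (λ p → (Occ? p ×-dec IndOcc? k (closure p)) ×-dec (closure p ≟ᶜ q)) cands ≡ 0
    off-class {k} q ¬ind-occ = count-none _ cands
      (λ p ((_ , ind-occ) , closure≡q) → ¬ind-occ (subst (IndOcc k) closure≡q ind-occ))

    class-count : ∀ k →
      count (λ p → Occ? p ×-dec IndOcc? k (closure p)) cands ≡ g k ℕ.* netCount (R k) G v
    class-count k =
      trans (count-fibres (λ p → Occ? p ×-dec IndOcc? k (closure p)) (λ p q → closure p ≟ᶜ q) cands
               (λ p _ → one-closure p) cands)
            (sumBy-indicator (IndOcc? k) cands (g k) on-class off-class)

  grossCount-decomposition :
    grossCount X G v
      ≡ sumBy (allFin N) (λ k → grossCount X (graph (R k)) (vR k) ℕ.* netCount (R k) G v)
  grossCount-decomposition =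
    trans (count-fibres Occ? (λ p k → IndOcc? k (closure p)) (allFin N) one-class cands)
          (sumBy-cong (allFin N) class-count)

private
  ℕtoℚᵘ : ℕ → ℚᵘ
  ℕtoℚᵘ k = mkℚᵘ (ℤ.+ k) 0

  -- ℕtoℚ k is definitionally fromℚᵘ (ℕtoℚᵘ k).
  toℚᵘ-ℕtoℚ : ∀ k → toℚᵘ (ℕtoℚ k) ℚᵘ.≃ ℕtoℚᵘ k
  toℚᵘ-ℕtoℚ k = ℚₚ.toℚᵘ-fromℚᵘ (ℕtoℚᵘ k)

  ℕtoℚᵘ-+ : ∀ a b → ℕtoℚᵘ a ℚᵘ.+ ℕtoℚᵘ b ℚᵘ.≃ ℕtoℚᵘ (a ℕ.+ b)
  ℕtoℚᵘ-+ a b = *≡* (trans (ℤₚ.*-identityʳ _)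
    (trans (cong₂ ℤ._+_ (ℤₚ.*-identityʳ (ℤ.+ a)) (ℤₚ.*-identityʳ (ℤ.+ b)))
           (sym (trans (ℤₚ.*-identityʳ _) (ℤₚ.pos-+ a b)))))

  ℕtoℚᵘ-* : ∀ a b → ℕtoℚᵘ a ℚᵘ.* ℕtoℚᵘ b ℚᵘ.≃ ℕtoℚᵘ (a ℕ.* b)
  ℕtoℚᵘ-* a b = *≡* (trans (ℤₚ.*-identityʳ _) (sym (trans (ℤₚ.*-identityʳ _) (ℤₚ.pos-* a b))))

ℕtoℚ-+ : ∀ a b → ℕtoℚ (a ℕ.+ b) ≡ ℕtoℚ a + ℕtoℚ b
ℕtoℚ-+ a b = ℚₚ.toℚᵘ-injective (ℚᵘₚ.≃-sym (ℚᵘₚ.≃-trans (ℚₚ.toℚᵘ-homo-+ (ℕtoℚ a) (ℕtoℚ b))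
  (ℚᵘₚ.≃-trans (ℚᵘₚ.+-cong (toℚᵘ-ℕtoℚ a) (toℚᵘ-ℕtoℚ b))
    (ℚᵘₚ.≃-trans (ℕtoℚᵘ-+ a b) (ℚᵘₚ.≃-sym (toℚᵘ-ℕtoℚ (a ℕ.+ b)))))))

ℕtoℚ-* : ∀ a b → ℕtoℚ (a ℕ.* b) ≡ ℕtoℚ a * ℕtoℚ b
ℕtoℚ-* a b = ℚₚ.toℚᵘ-injective (ℚᵘₚ.≃-sym (ℚᵘₚ.≃-trans (ℚₚ.toℚᵘ-homo-* (ℕtoℚ a) (ℕtoℚ b))
  (ℚᵘₚ.≃-trans (ℚᵘₚ.*-cong (toℚᵘ-ℕtoℚ a) (toℚᵘ-ℕtoℚ b))
    (ℚᵘₚ.≃-trans (ℕtoℚᵘ-* a b) (ℚᵘₚ.≃-sym (toℚᵘ-ℕtoℚ (a ℕ.* b)))))))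

ℕtoℚ-sumBy : ∀ {A : Set} N (g : Fin N → A) (f : A → ℕ) →
  ℕtoℚ (sumBy (List.tabulate g) f) ≡ sum (λ k → ℕtoℚ (f (g k)))
ℕtoℚ-sumBy zero g f = refl
ℕtoℚ-sumBy (suc N) g f =
  trans (ℕtoℚ-+ (f (g zero)) _) (cong (ℕtoℚ (f (g zero)) +_) (ℕtoℚ-sumBy N (g ∘ suc) f))

sumFin≡sum : ∀ k (f : Fin k → ℚ) → sumFin k f ≡ sum f
sumFin≡sum zero f = refl
sumFin≡sum (suc k) f = cong (f zero +_) (sumFin≡sum k (λ i → f (suc i)))

sum-δ : ∀ {k} (f : Fin k → ℚ) i → (∀ l → l ≢ i → f l ≡ 0ℚ) → sum f ≡ f i
sum-δ {suc k} f zero off = trans (cong (f zero +_) (trans (sum-cong-≗ (λ l → off (suc l) λ ()))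
  (sum-replicate-zero k))) (ℚₚ.+-identityʳ (f zero))
sum-δ {suc k} f (suc i) off = trans (cong (_+ sum (λ l → f (suc l))) (off zero λ ()))
  (trans (ℚₚ.+-identityˡ _) (sum-δ (λ l → f (suc l)) i (λ l l≢i → off (suc l) (l≢i ∘ suc-injective))))

_+ᴹ_ : ∀ {m n} → Mat m n → Mat m n → Mat m n
(A +ᴹ B) i j = A i j + B i j

0ᴹ : ∀ {m n} → Mat m n
0ᴹ i j = 0ℚ

Mat-setoid : ℕ → ℕ → Setoid _ _
Mat-setoid m n = record
  { Carrier = Mat m n
  ; _≈_ = _≈M_
  ; isEquivalence = record
    { refl = λ i j → refl
    ; sym = λ A≈B i j → sym (A≈B i j)
    ; trans = λ A≈B B≈C i j → trans (A≈B i j) (B≈C i j)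
    }
  }

module _ {m n : ℕ} where

  +ᴹ-congˡ : ∀ (A : Mat m n) {B B'} → B ≈M B' → (A +ᴹ B) ≈M (A +ᴹ B')
  +ᴹ-congˡ A B≈B' i j = cong (A i j +_) (B≈B' i j)

  +ᴹ-congʳ : ∀ {A A'} (B : Mat m n) → A ≈M A' → (A +ᴹ B) ≈M (A' +ᴹ B)
  +ᴹ-congʳ B A≈A' i j = cong (_+ B i j) (A≈A' i j)

  +ᴹ-assoc : ∀ (A B C : Mat m n) → ((A +ᴹ B) +ᴹ C) ≈M (A +ᴹ (B +ᴹ C))
  +ᴹ-assoc A B C i j = ℚₚ.+-assoc (A i j) (B i j) (C i j)

  +ᴹ-identityˡ : ∀ (A : Mat m n) → (0ᴹ +ᴹ A) ≈M A
  +ᴹ-identityˡ A i j = ℚₚ.+-identityˡ (A i j)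

  +ᴹ-identityʳ : ∀ (A : Mat m n) → (A +ᴹ 0ᴹ) ≈M A
  +ᴹ-identityʳ A i j = ℚₚ.+-identityʳ (A i j)

module _ {m k n : ℕ} where

  ·-as-sum : ∀ (A : Mat m k) (B : Mat k n) i j → (A · B) i j ≡ sum (λ l → A i l * B l j)
  ·-as-sum A B i j = sumFin≡sum k _

  ·-cong : ∀ {A A' : Mat m k} {B B' : Mat k n} → A ≈M A' → B ≈M B' → (A · B) ≈M (A' · B')
  ·-cong {A} {A'} {B} {B'} A≈A' B≈B' i j = begin
    (A · B) i j                  ≡⟨ ·-as-sum A B i j ⟩
    sum (λ l → A i l * B l j)    ≡⟨ sum-cong-≗ {x = λ l → A i l * B l j}
                                      (λ l → cong₂ _*_ (A≈A' i l) (B≈B' l j)) ⟩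
    sum (λ l → A' i l * B' l j)  ≡⟨ ·-as-sum A' B' i j ⟨
    (A' · B') i j                ∎
    where open ≡-Reasoning

  ·-distribˡ : ∀ (A : Mat m k) (B C : Mat k n) → (A · (B +ᴹ C)) ≈M ((A · B) +ᴹ (A · C))
  ·-distribˡ A B C i j = begin
    (A · (B +ᴹ C)) i j                                 ≡⟨ ·-as-sum A (B +ᴹ C) i j ⟩
    sum (λ l → A i l * (B l j + C l j))
      ≡⟨ sum-cong-≗ (λ l → ℚₚ.*-distribˡ-+ (A i l) _ _) ⟩
    sum (λ l → A i l * B l j + A i l * C l j)
      ≡⟨ ∑-distrib-+ (λ l → A i l * B l j) _ ⟩
    sum (λ l → A i l * B l j) + sum (λ l → A i l * C l j)
      ≡⟨ cong₂ _+_ (·-as-sum A B i j) (·-as-sum A C i j) ⟨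
    (A · B) i j + (A · C) i j                          ∎
    where open ≡-Reasoning

  ·-distribʳ : ∀ (A B : Mat m k) (C : Mat k n) → ((A +ᴹ B) · C) ≈M ((A · C) +ᴹ (B · C))
  ·-distribʳ A B C i j = begin
    ((A +ᴹ B) · C) i j                                 ≡⟨ ·-as-sum (A +ᴹ B) C i j ⟩
    sum (λ l → (A i l + B i l) * C l j)
      ≡⟨ sum-cong-≗ (λ l → ℚₚ.*-distribʳ-+ (C l j) (A i l) _) ⟩
    sum (λ l → A i l * C l j + B i l * C l j)
      ≡⟨ ∑-distrib-+ (λ l → A i l * C l j) _ ⟩
    sum (λ l → A i l * C l j) + sum (λ l → B i l * C l j)
      ≡⟨ cong₂ _+_ (·-as-sum A C i j) (·-as-sum B C i j) ⟨
    (A · C) i j + (B · C) i j                          ∎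
    where open ≡-Reasoning

  ·-zeroʳ : ∀ (A : Mat m k) → (A · 0ᴹ {k} {n}) ≈M 0ᴹ
  ·-zeroʳ A i j = trans (·-as-sum A 0ᴹ i j)
    (trans (sum-cong-≗ (λ l → ℚₚ.*-zeroʳ (A i l))) (sum-replicate-zero k))

  ·-zeroˡ : ∀ (B : Mat k n) → (0ᴹ {m} {k} · B) ≈M 0ᴹ
  ·-zeroˡ B i j = trans (·-as-sum 0ᴹ B i j)
    (trans (sum-cong-≗ (λ l → ℚₚ.*-zeroˡ (B l j))) (sum-replicate-zero k))

idMat-diag : ∀ {n} (i : Fin n) → idMat n i i ≡ 1ℚ
idMat-diag i with i ≟ᶠ i
... | yes _ = refl
... | no i≢i = ⊥-elim (i≢i refl)

idMat-off : ∀ {n} {i j : Fin n} → i ≢ j → idMat n i j ≡ 0ℚ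
idMat-off {i = i} {j} i≢j with i ≟ᶠ j
... | yes i≡j = ⊥-elim (i≢j i≡j)
... | no _ = refl

module _ {m n : ℕ} where

  ·-identityˡ : ∀ (A : Mat m n) → (idMat m · A) ≈M A
  ·-identityˡ A i j = begin
    (idMat m · A) i j
      ≡⟨ ·-as-sum (idMat m) A i j ⟩
    sum (λ l → idMat m i l * A l j)
      ≡⟨ sum-δ _ i (λ l l≢i → trans (cong (_* A l j) (idMat-off (l≢i ∘ sym))) (ℚₚ.*-zeroˡ (A l j))) ⟩
    idMat m i i * A i j
      ≡⟨ cong (_* A i j) (idMat-diag i) ⟩
    1ℚ * A i j
      ≡⟨ ℚₚ.*-identityˡ (A i j) ⟩
    A i j
      ∎
    where open ≡-Reasoning

  ·-identityʳ : ∀ (A : Mat m n) → (A · idMat n) ≈M A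
  ·-identityʳ A i j = begin
    (A · idMat n) i j
      ≡⟨ ·-as-sum A (idMat n) i j ⟩
    sum (λ l → A i l * idMat n l j)
      ≡⟨ sum-δ _ j (λ l l≢j → trans (cong (A i l *_) (idMat-off l≢j)) (ℚₚ.*-zeroʳ (A i l))) ⟩
    A i j * idMat n j j
      ≡⟨ cong (A i j *_) (idMat-diag j) ⟩
    A i j * 1ℚ
      ≡⟨ ℚₚ.*-identityʳ (A i j) ⟩
    A i j
      ∎
    where open ≡-Reasoning

·-assoc : ∀ {m k l n} (A : Mat m k) (B : Mat k l) (C : Mat l n) → ((A · B) · C) ≈M (A · (B · C))
·-assoc {k = k} {l} A B C i j = begin
  ((A · B) · C) i j
    ≡⟨ ·-as-sum (A · B) C i j ⟩
  sum (λ q → (A · B) i q * C q j)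
    ≡⟨ sum-cong-≗ (λ q → cong (_* C q j) (·-as-sum A B i q)) ⟩
  sum (λ q → sum (λ p → A i p * B p q) * C q j)
    ≡⟨ sum-cong-≗ (λ q → *-distribʳ-sum (C q j) (λ p → A i p * B p q)) ⟩
  sum (λ q → sum (λ p → A i p * B p q * C q j))
    ≡⟨ ∑-comm (λ q p → A i p * B p q * C q j) ⟩
  sum (λ p → sum (λ q → A i p * B p q * C q j))
    ≡⟨ sum-cong-≗ (λ p → sum-cong-≗ (λ q → ℚₚ.*-assoc (A i p) (B p q) (C q j))) ⟩
  sum (λ p → sum (λ q → A i p * (B p q * C q j)))
    ≡⟨ sum-cong-≗ (λ p → *-distribˡ-sum (A i p) (λ q → B p q * C q j)) ⟨
  sum (λ p → A i p * sum (λ q → B p q * C q j))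
    ≡⟨ sum-cong-≗ (λ p → cong (A i p *_) (·-as-sum B C p j)) ⟨
  sum (λ p → A i p * (B · C) p j)
    ≡⟨ ·-as-sum A (B · C) i j ⟨
  (A · (B · C)) i j
    ∎
  where open ≡-Reasoning

left-inverse-solves : ∀ {m n} {U : Mat m m} {V : Mat m m} {W U' : Mat m n} →
  (V · U) ≈M idMat m → (U · W) ≈M U' → W ≈M (V · U')
left-inverse-solves {m} {n} {U} {V} {W} {U'} VU≈I UW≈U' = begin
  W              ≈⟨ ·-identityˡ W ⟨
  idMat m · W    ≈⟨ ·-cong VU≈I (λ _ _ → refl) ⟨
  (V · U) · W    ≈⟨ ·-assoc V U W ⟩
  V · (U · W)    ≈⟨ ·-cong {A = V} (λ _ _ → refl) UW≈U' ⟩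
  V · U'         ∎
  where open import Relation.Binary.Reasoning.Setoid (Mat-setoid m n)

module _ {n : ℕ} (U : Mat n n) (w : Fin n → ℕ) {B : ℕ} (w≤B : ∀ i → w i ≤ B)
         (U-diag : ∀ i → U i i ≡ 1ℚ) (U-increasing : ∀ i j → i ≢ j → U i j ≢ 0ℚ → w i < w j) where

  private
    open import Relation.Binary.Reasoning.Setoid (Mat-setoid n n)
    open Setoid (Mat-setoid n n) using () renaming (refl to ≈-refl; sym to ≈-sym; trans to ≈-trans)

    N : Mat n n
    N i j = idMat n i j - U i j

    U+N≈I : (U +ᴹ N) ≈M idMat n
    U+N≈I i j = trans (sym (ℚₚ.+-assoc (U i j) (idMat n i j) (- U i j)))
                      (xyx⁻¹≈y (U i j) (idMat n i j))
      where
      open import Algebra.Properties.AbelianGroup (Ring.+-abelianGroup ℚₚ.+-*-ring) using (xyx⁻¹≈y)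

    N-increasing : ∀ i j → N i j ≢ 0ℚ → w i < w j
    N-increasing i j N≢0 = by-cases (i ≟ᶠ j)
      where
      by-cases : Dec (i ≡ j) → w i < w j
      by-cases (yes refl) =
        ⊥-elim (N≢0 (trans (cong₂ _-_ (idMat-diag i) (U-diag i)) (ℚₚ.+-inverseʳ 1ℚ)))
      by-cases (no i≢j) = U-increasing i j i≢j
        (λ U≡0 → N≢0 (trans (cong₂ _-_ (idMat-off i≢j) U≡0) (ℚₚ.+-inverseʳ 0ℚ)))

    N^ : ℕ → Mat n n
    N^ zero = idMat n
    N^ (suc k) = N · N^ k

    -- Each factor N raises the weight, so the entries of N^k connect weights at least k apart.
    N^-vanishes : ∀ k i j → w j < w i ℕ.+ k → N^ k i j ≡ 0ℚ
    N^-vanishes zero i j j<i+0 =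
      idMat-off {i = i} {j} λ { refl → ℕₚ.<-irrefl refl (subst (w j <_) (ℕₚ.+-identityʳ _) j<i+0) }
    N^-vanishes (suc k) i j j<i+1+k = trans (·-as-sum N (N^ k) i j)
      (trans (sum-cong-≗ term) (sum-replicate-zero n))
      where
      term : ∀ l → N i l * N^ k l j ≡ 0ℚ
      term l with N i l ℚₚ.≟ 0ℚ
      ... | yes N≡0 = trans (cong (_* N^ k l j) N≡0) (ℚₚ.*-zeroˡ (N^ k l j))
      ... | no N≢0 = trans (cong (N i l *_) (N^-vanishes k l j j<l+k)) (ℚₚ.*-zeroʳ (N i l))
        where
        j<l+k : w j < w l ℕ.+ k
        j<l+k = ℕₚ.<-≤-trans j<i+1+k
          (subst (ℕ._≤ w l ℕ.+ k) (sym (ℕₚ.+-suc (w i) k)) (ℕₚ.+-monoˡ-≤ k (N-increasing i l N≢0)))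

    N^-nilpotent : N^ (suc B) ≈M 0ᴹ
    N^-nilpotent i j = N^-vanishes (suc B) i j (ℕₚ.≤-trans (s≤s (w≤B j)) (ℕₚ.m≤n+m (suc B) (w i)))

    N^-comm : ∀ k → (N^ k · N) ≈M (N · N^ k)
    N^-comm zero = ≈-trans (·-identityˡ N) (≈-sym (·-identityʳ N))
    N^-comm (suc k) = ≈-trans (·-assoc N (N^ k) N) (·-cong {A = N} {N} (λ _ _ → refl) (N^-comm k))

    series : ℕ → Mat n n
    series zero = 0ᴹ
    series (suc k) = series k +ᴹ N^ k

    U·series : ∀ k → ((U · series k) +ᴹ N^ k) ≈M idMat n
    U·series zero = ≈-trans (+ᴹ-congʳ (idMat n) (·-zeroʳ U)) (+ᴹ-identityˡ (idMat n))
    U·series (suc k) = begin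
      (U · (series k +ᴹ N^ k)) +ᴹ (N · N^ k)
        ≈⟨ +ᴹ-congʳ (N · N^ k) (·-distribˡ U (series k) (N^ k)) ⟩
      ((U · series k) +ᴹ (U · N^ k)) +ᴹ (N · N^ k)
        ≈⟨ +ᴹ-assoc (U · series k) (U · N^ k) (N · N^ k) ⟩
      (U · series k) +ᴹ ((U · N^ k) +ᴹ (N · N^ k))
        ≈⟨ +ᴹ-congˡ (U · series k) (·-distribʳ U N (N^ k)) ⟨
      (U · series k) +ᴹ ((U +ᴹ N) · N^ k)
        ≈⟨ +ᴹ-congˡ (U · series k) (·-cong {B = N^ k} U+N≈I (λ _ _ → refl)) ⟩
      (U · series k) +ᴹ (idMat n · N^ k)
        ≈⟨ +ᴹ-congˡ (U · series k) (·-identityˡ (N^ k)) ⟩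
      (U · series k) +ᴹ N^ k
        ≈⟨ U·series k ⟩
      idMat n
        ∎

    series·U : ∀ k → ((series k · U) +ᴹ N^ k) ≈M idMat n
    series·U zero = ≈-trans (+ᴹ-congʳ (idMat n) (·-zeroˡ U)) (+ᴹ-identityˡ (idMat n))
    series·U (suc k) = begin
      ((series k +ᴹ N^ k) · U) +ᴹ (N · N^ k)
        ≈⟨ +ᴹ-congʳ (N · N^ k) (·-distribʳ (series k) (N^ k) U) ⟩
      ((series k · U) +ᴹ (N^ k · U)) +ᴹ (N · N^ k)
        ≈⟨ +ᴹ-congˡ ((series k · U) +ᴹ (N^ k · U)) (N^-comm k) ⟨
      ((series k · U) +ᴹ (N^ k · U)) +ᴹ (N^ k · N)
        ≈⟨ +ᴹ-assoc (series k · U) (N^ k · U) (N^ k · N) ⟩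
      (series k · U) +ᴹ ((N^ k · U) +ᴹ (N^ k · N))
        ≈⟨ +ᴹ-congˡ (series k · U) (·-distribˡ (N^ k) U N) ⟨
      (series k · U) +ᴹ (N^ k · (U +ᴹ N))
        ≈⟨ +ᴹ-congˡ (series k · U) (·-cong {A = N^ k} (λ _ _ → refl) U+N≈I) ⟩
      (series k · U) +ᴹ (N^ k · idMat n)
        ≈⟨ +ᴹ-congˡ (series k · U) (·-identityʳ (N^ k)) ⟩
      (series k · U) +ᴹ N^ k
        ≈⟨ series·U k ⟩
      idMat n
        ∎

  -- I - U is nilpotent, so U is inverted by the finite geometric series Σₖ (I - U)ᵏ.
  weightedUnitriangular-inverse : Σ (Mat n n) λ V → (V · U) ≈M idMat n × (U · V) ≈M idMat n
  weightedUnitriangular-inverse = series (suc B) ,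
    (begin
      series (suc B) · U                       ≈⟨ +ᴹ-identityʳ _ ⟨
      (series (suc B) · U) +ᴹ 0ᴹ               ≈⟨ +ᴹ-congˡ (series (suc B) · U) N^-nilpotent ⟨
      (series (suc B) · U) +ᴹ N^ (suc B)       ≈⟨ series·U (suc B) ⟩
      idMat n                                  ∎) ,
    (begin
      U · series (suc B)                       ≈⟨ +ᴹ-identityʳ _ ⟨
      (U · series (suc B)) +ᴹ 0ᴹ               ≈⟨ +ᴹ-congˡ (U · series (suc B)) N^-nilpotent ⟨
      (U · series (suc B)) +ᴹ N^ (suc B)       ≈⟨ U·series (suc B) ⟩
      idMat n                                  ∎)

module _ (N : ℕ → ℕ) (R : (s : ℕ) → Fin (N s) → Graphlet s) (v : (s : ℕ) → Fin (N s) → Fin s) where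

  UBlock-below : ∀ {s s'} → s' < s → ∀ i j → UBlock N R v s s' i j ≡ 0ℚ
  UBlock-below {s} {s'} s'<s i j =
    cong ℕtoℚ (grossCount-larger (R s i) (graph (R s' j)) (v s' j) s'<s)

  WBlock-below : ∀ {s s'} → s' < s → ∀ i j → WBlock N R v s s' i j ≡ 0ℚ
  WBlock-below {s} {s'} s'<s i j =
    cong ℕtoℚ (netCount-larger (R s i) (graph (R s' j)) (v s' j) s'<s)

  module _ {s} (R-enum : IsGraphletEnumeration s (N s) (R s))
           (v-orbit : ∀ j → Orbit (graph (R s j)) (root (R s j)) (v s j)) where

    UBlock-diag : ∀ i → UBlock N R v s s i i ≡ 1ℚ
    UBlock-diag i = cong ℕtoℚ (grossCount-self (R s i) (v-orbit i))

    UBlock-increasing : ∀ i j → i ≢ j → UBlock N R v s s i j ≢ 0ℚ →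
      edgeCount (graph (R s i)) < edgeCount (graph (R s j))
    UBlock-increasing i j i≢j U≢0
      with count≢0⇒∃ (Occurrence? (graph (R s i)) (root (R s i)) (graph (R s j)) (v s j))
                     (candidates s) (λ g≡0 → U≢0 (cong ℕtoℚ g≡0))
    ... | (S , E) , occ with occurrence-same-size (R s i) (R s j) {S = S} {E} (v-orbit j) occ
    ...   | inj₁ R≅R = ⊥-elim (i≢j (proj₂ R-enum i j R≅R))
    ...   | inj₂ fewer = fewer

    UBlock-factorization : ∀ s' → (UBlock N R v s s · WBlock N R v s s') ≈M UBlock N R v s s'
    UBlock-factorization s' i j = begin
      (U · W) i j
        ≡⟨ ·-as-sum U W i j ⟩
      sum (λ k → U i k * W k j)
        ≡⟨ sum-cong-≗ (λ k → ℕtoℚ-* (g k) (f k)) ⟨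
      sum (λ k → ℕtoℚ (g k ℕ.* f k))
        ≡⟨ ℕtoℚ-sumBy (N s) (λ k → k) (λ k → g k ℕ.* f k) ⟨
      ℕtoℚ (sumBy (allFin (N s)) (λ k → g k ℕ.* f k))
        ≡⟨ cong ℕtoℚ (grossCount-decomposition {R = R s} R-enum v-orbit (R s i) (graph (R s' j)) _) ⟨
      UBlock N R v s s' i j
        ∎
      where
      open ≡-Reasoning
      U = UBlock N R v s s
      W = WBlock N R v s s'
      g = λ k → grossCount (R s i) (graph (R s k)) (v s k)
      f = λ k → netCount (R s k) (graph (R s' j)) (v s' j)

corollary2 :
    (t : ℕ) → 1 < t →
    (N : ℕ → ℕ) (R : (s : ℕ) → Fin (N s) → Graphlet s) →
    (∀ s → 1 ≤ s → s ≤ t → IsGraphletEnumeration s (N s) (R s)) →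
    (v : (s : ℕ) → Fin (N s) → Fin s) →
    (∀ s → 1 ≤ s → s ≤ t → ∀ j → Orbit (graph (R s j)) (root (R s j)) (v s j)) →
    -- block upper triangularity of Ũ_t and W̃_t
    (∀ s s' → 1 ≤ s' → s' < s → s ≤ t →
       (∀ i j → UBlock N R v s s' i j ≡ 0ℚ) × (∀ i j → WBlock N R v s s' i j ≡ 0ℚ)) ×
    -- W̃_t = diag(U_1⁻¹ , … , U_t⁻¹) Ũ_t
    (∀ s → 1 ≤ s → s ≤ t →
       Σ (Mat (N s) (N s)) (λ V →
         (V · UBlock N R v s s) ≈M idMat (N s) ×
         (UBlock N R v s s · V) ≈M idMat (N s) ×
         (∀ s' → 1 ≤ s' → s' ≤ t → WBlock N R v s s' ≈M (V · UBlock N R v s s'))))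
corollary2 t _ N R enum v orbit =
  (λ s s' _ s'<s _ → UBlock-below N R v s'<s , WBlock-below N R v s'<s) ,
  λ s 1≤s s≤t →
    let R-enum = enum s 1≤s s≤t
        v-orbit = orbit s 1≤s s≤t
        U = UBlock N R v s s
        edges≤pairs = λ i → length-filter (isEdge? (graph (R s i))) (vertexPairs s)
        (V , VU≈I , UV≈I) = weightedUnitriangular-inverse U (edgeCount ∘ graph ∘ R s) edges≤pairs
                              (UBlock-diag N R v R-enum v-orbit) (UBlock-increasing N R v R-enum v-orbit)
    in V , VU≈I , UV≈I ,
       λ s' _ _ → left-inverse-solves {U = U} {V} VU≈I (UBlock-factorization N R v R-enum v-orbit s')
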